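{- Let $G$ and $H$ be finite simple undirected graphs of orders $m\ge 1$ and $n\ge 1$, respectively. Then for each $\widehat\delta\in\{\widehat\delta_{(1)},\widehat\delta_1,\widehat\delta_\square\}$ the limit \[ \lim_{\ell\to\infty}\widehat\delta\big(G^{\odot \ell n},H^{\odot \ell m}\big) \] exists.
   Context: For a graph $G$ with vertex set $V$, its adjacency matrix $A_G\in\{0,1\}^{V\times V}$ has $A_G(v,v')=1$ iff $vv'$ is an edge. For a matrix $A\in\mathbb{R}^{V\times V}$ and a bijection $\pi:V\to W$, let $A^\pi\in\mathbb{R}^{W\times W}$ be given by $A^\pi(w,w')=A(\pi^{ -1}(w),\pi^{ -1}(w'))$. Matrix norms for $B\in\mathbb{R}^{I\times J}$: entrywise 1-norm $\|B\|_{(1)}=\sum_{i,j}|B(i,j)|$; operator 1-norm $\|B\|_1=\sup_{x\neq 0}\|Bx\|_1/\|x\|_1$ (where $\|x\|_1=\sum_j|x(j)|$); cut norm $\|B\|_\square=\max_{S\subseteq I,T\subseteq J}\big|\sum_{i\in S,j\in T}B(i,j)\big|$. For graphs $G=(V,E_G)$, $H=(W,E_H)$ of the same order $N$, and $\|\cdot\|$ one of these norms, define $\delta_{\|\cdot\|}(G,H)=\min_{\pi}\|A_G^\pi-A_H\|$, the minimum over all bijections $\pi:V\to W$; write $\delta_{(1)},\delta_1,\delta_\square$ respectively. Normalised versions: $\widehat\delta_{(1)}(G,H)=\delta_{(1)}(G,H)/N^2$, $\widehat\delta_1(G,H)=\delta_1(G,H)/N$, $\widehat\delta_\square(G,H)=\delta_\square(G,H)/N^2$.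 For a graph $G$ and $k\ge 1$, the blow-up $G^{\odot k}$ is the graph with vertex set $V_G\times[k]$ in which $(v,i)(w,j)$ is an edge iff $vw$ is an edge of $G$ (so $|G^{\odot k}|=k|G|$). Note that $G^{\odot\ell n}$ and $H^{\odot \ell m}$ both have order $\ell mn$. -}

module Defs where

open import Data.Bool using (Bool; true; false; if_then_else_; _∧_)
open import Data.Nat as ℕ using (ℕ; zero; suc)
open import Data.Fin using (Fin; zero; suc; remQuot)
open import Data.Product using (_×_; _,_; proj₁; Σ; ∃; ∃-syntax)
open import Data.Rational using (ℚ; 0ℚ; 1ℚ; _+_; _-_; _*_; _≤_; _<_; ∣_∣; _/_)
open import Data.Integer using (+_)
open import Function.Bundles using (_↔_; Inverse)
open import Relation.Binary.PropositionalEquality using (_≡_)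

record SimpleGraph (m : ℕ) : Set where
  field
    adj    : Fin m → Fin m → Bool
    sym    : ∀ i j → adj i j ≡ adj j i
    irrefl : ∀ i → adj i i ≡ false
open SimpleGraph public

-- real-valued matrices are represented by rational-valued ones
Matrix : ℕ → ℕ → Set
Matrix a b = Fin a → Fin b → ℚ

adjMat : ∀ {m} → SimpleGraph m → Matrix m m
adjMat G i j = if adj G i j then 1ℚ else 0ℚ

-- blow-up G^{⊙k}: vertex set V_G × [k], encoded as Fin (m * k) via remQuot
blowup : ∀ {m} → SimpleGraph m → (k : ℕ) → SimpleGraph (m ℕ.* k)
blowup {m} G k = record
  { adj    = λ i j → adj G (proj₁ (remQuot k i)) (proj₁ (remQuot k j))
  ; sym    = λ i j → sym G (proj₁ (remQuot k i)) (proj₁ (remQuot k j))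
  ; irrefl = λ i → irrefl G (proj₁ (remQuot k i))
  }

Σℚ : ∀ {n} → (Fin n → ℚ) → ℚ
Σℚ {zero}  f = 0ℚ
Σℚ {suc n} f = f zero + Σℚ (λ i → f (suc i))

norm₍₁₎ : ∀ {a b} → Matrix a b → ℚ
norm₍₁₎ B = Σℚ (λ i → Σℚ (λ j → ∣ B i j ∣))

vnorm₁ : ∀ {b} → (Fin b → ℚ) → ℚ
vnorm₁ x = Σℚ (λ j → ∣ x j ∣)

_·v_ : ∀ {a b} → Matrix a b → (Fin b → ℚ) → Fin a → ℚ
(B ·v x) i = Σℚ (λ j → B i j * x j)

IsOpNorm₁ : ∀ {a b} → Matrix a b → ℚ → Set
IsOpNorm₁ B d =
  (∀ x → vnorm₁ (B ·v x) ≤ d * vnorm₁ x) ×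
  (∀ d' → (∀ x → vnorm₁ (B ·v x) ≤ d' * vnorm₁ x) → d ≤ d')

blockSum : ∀ {a b} → Matrix a b → (Fin a → Bool) → (Fin b → Bool) → ℚ
blockSum B S T = Σℚ (λ i → Σℚ (λ j → if S i ∧ T j then B i j else 0ℚ))

IsCutNorm : ∀ {a b} → Matrix a b → ℚ → Set
IsCutNorm B d =
  (∃[ S ] ∃[ T ] ∣ blockSum B S T ∣ ≡ d) ×
  (∀ S T → ∣ blockSum B S T ∣ ≤ d)

data NormKind : Set where
  entrywise operator cut : NormKind

IsNorm : NormKind → ∀ {a b} → Matrix a b → ℚ → Set
IsNorm entrywise B d = norm₍₁₎ B ≡ d
IsNorm operator  B d = IsOpNorm₁ B d
IsNorm cut       B d = IsCutNorm B d

permDiff : ∀ {N M} → Matrix N N → (Fin N ↔ Fin M) → Matrix M M → Matrix M M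
permDiff A π B w w' = A (Inverse.from π w) (Inverse.from π w') - B w w'

IsDist : NormKind → ∀ {N M} → SimpleGraph N → SimpleGraph M → ℚ → Set
IsDist κ {N} {M} G H d =
  (∃[ π ] IsNorm κ (permDiff (adjMat G) π (adjMat H)) d) ×
  (∀ (π : Fin N ↔ Fin M) e → IsNorm κ (permDiff (adjMat G) π (adjMat H)) e → d ≤ e)

-- 1/k as a rational (only used for k ≥ 1; value 0 at k = 0 is irrelevant)
recipℕ : ℕ → ℚ
recipℕ zero    = 0ℚ
recipℕ (suc k) = + 1 / suc k

-- normalising factor: 1/N² for δ_(1), δ_□ and 1/N for δ_1
scale : NormKind → ℕ → ℚ
scale entrywise N = recipℕ (N ℕ.* N)
scale operator  N = recipℕ N
scale cut       N = recipℕ (N ℕ.* N)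

IsNormDist : NormKind → ∀ {N M} → SimpleGraph N → SimpleGraph M → ℚ → Set
IsNormDist κ {N} G H a = ∃[ d ] (IsDist κ G H d × a ≡ d * scale κ N)

-- A sequence (ℓ ↦ the unique a with R ℓ a, for ℓ ≥ 1) is well defined and
-- converges (in ℝ), expressed via the Cauchy criterion
ConvergentRel : (ℕ → ℚ → Set) → Set
ConvergentRel R =
  (∀ ℓ → 1 ℕ.≤ ℓ → ∃[ a ] R ℓ a) ×
  (∀ ε → 0ℚ < ε → ∃[ L ] (∀ ℓ ℓ' a a' → L ℕ.≤ ℓ → L ℕ.≤ ℓ' → 1 ℕ.≤ ℓ → 1 ℕ.≤ ℓ' →
      R ℓ a → R ℓ' a' → ∣ a - a' ∣ < ε))

{-# OPTIONS --safe #-}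
module Submission where

-- At level ℓ, a bijection π from the vertices of G^{⊙ℓn} to those of H^{⊙ℓm}
-- gives every vertex w of H^{⊙ℓm} a type: the pair of vertices of G and H blown up
-- to π⁻¹ w and to w. All three norms of A_G^π − A_H only depend on how many vertices
-- have each type, that is on the coupling of π, an m × n matrix with row sums ℓn and
-- column sums ℓm; conversely every such matrix is the coupling of a bijection. Given
-- an optimal π at level k, round k′/k times its coupling to an integral matrix with
-- the margins of level k′, entrywise within 1 and without creating new types (by
-- augmenting paths, as for transportation problems), and realise it at level k′.
-- Comparing the norms type by type bounds the normalised distance at level k′ by the
-- one at level k plus 4/k + 4/k′; by symmetry the sequence is Cauchy.


module FinSum where

  open import Data.Nat
  open import Data.Nat.Properties
  open import Data.Fin using (Fin; zero; suc; _↑ˡ_; _↑ʳ_; combine; cast)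
  open import Data.Fin.Properties using () renaming (_≟_ to _≟ᶠ_)
  open import Data.Bool using (Bool; true; false; not)
  open import Relation.Binary.PropositionalEquality
  open import Relation.Nullary using (does; yes; no; contradiction)
  open import Function using (_∘_)

  open import Algebra.Properties.Semiring.Sum +-*-semiring public
    using (sum; sum-syntax; sum-cong-≗; sum-replicate-zero; ∑-distrib-+; ∑-comm; *-distribˡ-sum; *-distribʳ-sum)

  𝟙 : Bool → ℕ
  𝟙 true  = 1
  𝟙 false = 0

  𝟙≤1 : ∀ b → 𝟙 b ≤ 1
  𝟙≤1 true  = ≤-refl
  𝟙≤1 false = z≤n

  δ : ∀ {n} → Fin n → Fin n → ℕ
  δ i j = 𝟙 (does (i ≟ᶠ j))

  δ-refl : ∀ {n} (i : Fin n) → δ i i ≡ 1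
  δ-refl i with i ≟ᶠ i
  ... | yes _  = refl
  ... | no i≢i = contradiction refl i≢i

  δ-≢ : ∀ {n} {i j : Fin n} → i ≢ j → δ i j ≡ 0
  δ-≢ {i = i} {j} i≢j with i ≟ᶠ j
  ... | yes i≡j = contradiction i≡j i≢j
  ... | no _    = refl

  δ-sym : ∀ {n} (i j : Fin n) → δ i j ≡ δ j i
  δ-sym i j with i ≟ᶠ j | j ≟ᶠ i
  ... | yes _   | yes _   = refl
  ... | no _    | no _    = refl
  ... | yes i≡j | no j≢i  = contradiction (sym i≡j) j≢i
  ... | no i≢j  | yes j≡i = contradiction (sym j≡i) i≢j

  sum-const : ∀ n c → ∑[ _ < n ] c ≡ n * c
  sum-const zero    c = refl
  sum-const (suc n) c = cong (c +_) (sum-const n c)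

  sum-mono-≤ : ∀ {n} {f g : Fin n → ℕ} → (∀ i → f i ≤ g i) → sum f ≤ sum g
  sum-mono-≤ {zero}  f≤g = z≤n
  sum-mono-≤ {suc n} f≤g = +-mono-≤ (f≤g zero) (sum-mono-≤ (f≤g ∘ suc))

  sum-mono-< : ∀ {n} {f g : Fin n → ℕ} → (∀ i → f i ≤ g i) → ∀ a → f a < g a → sum f < sum g
  sum-mono-< f≤g zero    fa<ga = +-mono-<-≤ fa<ga (sum-mono-≤ (f≤g ∘ suc))
  sum-mono-< f≤g (suc a) fa<ga = +-mono-≤-< (f≤g zero) (sum-mono-< (f≤g ∘ suc) a fa<ga)

  sum-≤-const : ∀ {n} {f : Fin n → ℕ} c → (∀ i → f i ≤ c) → sum f ≤ n * c
  sum-≤-const {n} c f≤c = ≤-trans (sum-mono-≤ f≤c) (≤-reflexive (sum-const n c))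

  f≤sum : ∀ {n} (f : Fin n → ℕ) i → f i ≤ sum f
  f≤sum f zero    = m≤m+n (f zero) _
  f≤sum f (suc i) = ≤-trans (f≤sum (f ∘ suc) i) (m≤n+m _ (f zero))

  sum-*ˡ : ∀ {n} c (f : Fin n → ℕ) → ∑[ i < n ] (c * f i) ≡ c * sum f
  sum-*ˡ c f = sym (*-distribˡ-sum c f)

  sum-*ʳ : ∀ {n} c (f : Fin n → ℕ) → ∑[ i < n ] (f i * c) ≡ sum f * c
  sum-*ʳ c f = sym (*-distribʳ-sum c f)

  sum-δ : ∀ {n} (i : Fin n) (f : Fin n → ℕ) → ∑[ j < n ] (δ i j * f j) ≡ f i
  sum-δ {suc n} zero f = begin
    1 * f zero + ∑[ j < n ] 0      ≡⟨ cong₂ _+_ (*-identityˡ (f zero)) (sum-replicate-zero n) ⟩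
    f zero + 0                     ≡⟨ +-identityʳ (f zero) ⟩
    f zero                         ∎
    where open ≡-Reasoning
  sum-δ {suc n} (suc i) f = begin
    δ (suc i) zero * f zero + ∑[ j < n ] (δ (suc i) (suc j) * f (suc j))
      ≡⟨ cong (δ (suc i) zero * f zero +_) (sum-cong-≗ (λ j → cong (λ b → 𝟙 b * f (suc j)) (does-suc i j))) ⟩
    0 + ∑[ j < n ] (δ i j * f (suc j))  ≡⟨ sum-δ i (f ∘ suc) ⟩
    f (suc i)                           ∎
    where
    open ≡-Reasoning
    does-suc : ∀ {n} (i j : Fin n) → does (suc i ≟ᶠ suc j) ≡ does (i ≟ᶠ j)
    does-suc i j with i ≟ᶠ j
    ... | yes _ = refl
    ... | no _  = refl

  sum-δ-count : ∀ {n} (i : Fin n) → ∑[ j < n ] δ i j ≡ 1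
  sum-δ-count i = trans (sum-cong-≗ (λ j → sym (*-identityʳ (δ i j)))) (sum-δ i (λ _ → 1))

  sum-↑ : ∀ p q (f : Fin (p + q) → ℕ) → sum f ≡ ∑[ i < p ] f (i ↑ˡ q) + ∑[ j < q ] f (p ↑ʳ j)
  sum-↑ zero    q f = refl
  sum-↑ (suc p) q f = trans (cong (f zero +_) (sum-↑ p q (f ∘ suc))) (sym (+-assoc (f zero) _ _))

  sum-combine : ∀ m K (f : Fin (m * K) → ℕ) → sum f ≡ ∑[ i < m ] ∑[ j < K ] f (combine i j)
  sum-combine zero    K f = refl
  sum-combine (suc m) K f = trans (sum-↑ K (m * K) f) (cong (∑[ j < K ] f (j ↑ˡ (m * K)) +_) (sum-combine m K (f ∘ (K ↑ʳ_))))

  sum-cast : ∀ {a b} .(a≡b : a ≡ b) (f : Fin b → ℕ) → ∑[ i < a ] f (cast a≡b i) ≡ sum f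
  sum-cast {zero}  {zero}  _   f = refl
  sum-cast {suc a} {suc b} a≡b f = cong (f zero +_) (sum-cast (suc-injective a≡b) (f ∘ suc))

  ∣sum-sum∣≤sum∣-∣ : ∀ {n} (f g : Fin n → ℕ) → ∣ sum f - sum g ∣ ≤ ∑[ i < n ] ∣ f i - g i ∣
  ∣sum-sum∣≤sum∣-∣ {zero}  f g = z≤n
  ∣sum-sum∣≤sum∣-∣ {suc n} f g = begin
    ∣ f zero + sum (f ∘ suc) - g zero + sum (g ∘ suc) ∣
      ≤⟨ ∣-∣-triangle (f zero + sum (f ∘ suc)) (g zero + sum (f ∘ suc)) (g zero + sum (g ∘ suc)) ⟩
    ∣ f zero + sum (f ∘ suc) - g zero + sum (f ∘ suc) ∣ + ∣ g zero + sum (f ∘ suc) - g zero + sum (g ∘ suc) ∣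
      ≡⟨ cong₂ _+_ (trans (cong₂ ∣_-_∣ (+-comm (f zero) _) (+-comm (g zero) _)) (∣m+n-m+o∣≡∣n-o∣ (sum (f ∘ suc)) (f zero) (g zero)))
                   (∣m+n-m+o∣≡∣n-o∣ (g zero) _ _) ⟩
    ∣ f zero - g zero ∣ + ∣ sum (f ∘ suc) - sum (g ∘ suc) ∣
      ≤⟨ +-monoʳ-≤ ∣ f zero - g zero ∣ (∣sum-sum∣≤sum∣-∣ (f ∘ suc) (g ∘ suc)) ⟩
    ∣ f zero - g zero ∣ + ∑[ i < n ] ∣ f (suc i) - g (suc i) ∣ ∎
    where open ≤-Reasoning

  sum-split-𝟙 : ∀ {n} (S : Fin n → Bool) (f : Fin n → ℕ) →
    sum f ≡ ∑[ j < n ] (𝟙 (S j) * f j) + ∑[ j < n ] (𝟙 (not (S j)) * f j)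
  sum-split-𝟙 S f = trans (sum-cong-≗ (λ j → split (S j) (f j))) (∑-distrib-+ (λ j → 𝟙 (S j) * f j) _)
    where
    split : ∀ b x → x ≡ 𝟙 b * x + 𝟙 (not b) * x
    split true  x = sym (trans (+-identityʳ (x + 0)) (+-identityʳ x))
    split false x = sym (+-identityʳ x)

  sum₂-*ʳ : ∀ {m n} c (f : Fin m → Fin n → ℕ) → ∑[ i < m ] ∑[ j < n ] (f i j * c) ≡ (∑[ i < m ] ∑[ j < n ] f i j) * c
  sum₂-*ʳ c f = trans (sum-cong-≗ (λ i → sum-*ʳ c (f i))) (sum-*ʳ c (λ i → sum (f i)))

  sum₂-distrib-+ : ∀ {m n} (f g : Fin m → Fin n → ℕ) →
    ∑[ i < m ] ∑[ j < n ] (f i j + g i j) ≡ ∑[ i < m ] ∑[ j < n ] f i j + ∑[ i < m ] ∑[ j < n ] g i j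
  sum₂-distrib-+ f g = trans (sum-cong-≗ (λ i → ∑-distrib-+ (f i) (g i))) (∑-distrib-+ (λ i → sum (f i)) (λ i → sum (g i)))


module Reachability where

  open import Data.Nat using (ℕ; zero; suc; _≤_; _<_; s≤s; z≤n)
  open import Data.Nat.Properties using (≤-refl; ≤-reflexive; ≤-trans; m<n⇒m<1+n; <-irrefl; *-identityʳ)
  open import Data.Fin using (Fin)
  open import Data.Fin.Properties using (any?; all?; ¬∀⟶∃¬) renaming (_≟_ to _≟ᶠ_)
  open import Data.Bool using (Bool; true; false; _∨_; T)
  open import Data.Bool.Properties using (T-∨)
  open import Data.Product using (Σ-syntax; ∃-syntax; _×_; _,_)
  open import Data.Sum using (_⊎_; inj₁; inj₂)
  open import Data.Unit using (⊤; tt)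
  open import Function using (Equivalence)
  open import Relation.Nullary using (Dec; yes; no; ¬_; contradiction)
  open import Relation.Nullary.Decidable using (isYes; T?; _×-dec_; _→-dec_; toWitness; fromWitness)
  open import Relation.Binary.PropositionalEquality using (_≡_; _≢_; refl; cong)
  open import Relation.Binary.Construct.Closure.ReflexiveTransitive using (Star; ε; _◅_; _◅◅_)
  open FinSum using (sum; 𝟙; 𝟙≤1; f≤sum; sum-mono-<; sum-≤-const)

  module _ {n ℓ} {E : Fin n → Fin n → Set ℓ} where

    length : ∀ {a c} → Star E a c → ℕ
    length ε       = 0
    length (_ ◅ p) = suc (length p)

    -- x is none of the vertices of p after its first one
    _∉_ : ∀ {a c} → Fin n → Star E a c → Set
    x ∉ ε                   = ⊤
    x ∉ (_◅_ {j = b} _ p) = b ≢ x × x ∉ p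

    shortcut : ∀ {a d} x (p : Star E a d) → x ∉ p ⊎ Σ[ q ∈ Star E x d ] length q < length p
    shortcut x ε = inj₁ tt
    shortcut x (_◅_ {j = b} _ p) with b ≟ᶠ x | shortcut x p
    ... | yes refl | _              = inj₂ (p , ≤-refl)
    ... | no b≢x   | inj₁ x∉p       = inj₁ (b≢x , x∉p)
    ... | no _     | inj₂ (q , q<p) = inj₂ (q , m<n⇒m<1+n q<p)

  transport : ∀ {n ℓ ℓ′} {E : Fin n → Fin n → Set ℓ} {E′ : Fin n → Fin n → Set ℓ′} {b d} a₀ b₀ →
    (∀ {x y} → x ≢ a₀ → y ≢ b₀ → E x y → E′ x y) →
    (p : Star E b d) → b ≢ a₀ → a₀ ∉ p → b₀ ∉ p → Σ[ q ∈ Star E′ b d ] length q ≡ length p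
  transport a₀ b₀ E⊆E′ ε                 _    _              _              = ε , refl
  transport a₀ b₀ E⊆E′ (_◅_ {j = c} e p) b≢a₀ (c≢a₀ , a₀∉p) (c≢b₀ , b₀∉p) =
    let q , |q|≡|p| = transport a₀ b₀ E⊆E′ p c≢a₀ a₀∉p b₀∉p
    in E⊆E′ b≢a₀ c≢b₀ e ◅ q , cong suc |q|≡|p|

  module Closure {n ℓ} (E : Fin n → Fin n → Set ℓ) (E? : ∀ a b → Dec (E a b)) (s : Fin n) where

    reach : ℕ → Fin n → Bool
    reach zero    b = isYes (b ≟ᶠ s)
    reach (suc t) b = reach t b ∨ isYes (any? (λ a → T? (reach t a) ×-dec E? a b))

    reach-path : ∀ t b → T (reach t b) → Star E s b
    reach-path zero    b b≡s with refl ← toWitness b≡s = ε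
    reach-path (suc t) b r with Equivalence.to T-∨ r
    ... | inj₁ r′ = reach-path t b r′
    ... | inj₂ e  = let a , ra , a→b = toWitness e in reach-path t a ra ◅◅ (a→b ◅ ε)

    reach-mono : ∀ t b → T (reach t b) → T (reach (suc t) b)
    reach-mono t b r = Equivalence.from T-∨ (inj₁ r)

    reach-step : ∀ t {a b} → T (reach t a) → E a b → T (reach (suc t) b)
    reach-step t {a} {b} ra a→b =
      Equivalence.from (T-∨ {reach t b}) (inj₂ (fromWitness {a? = any? (λ a → T? (reach t a) ×-dec E? a b)} (a , ra , a→b)))

    reach-start : ∀ t → T (reach t s)
    reach-start zero    = fromWitness refl
    reach-start (suc t) = reach-mono t s (reach-start t)

    Stable : ℕ → Set
    Stable t = ∀ b → T (reach (suc t) b) → T (reach t b)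

    count : ℕ → ℕ
    count t = sum (λ b → 𝟙 (reach t b))

    private
      𝟙-mono : ∀ {x y} → (T x → T y) → 𝟙 x ≤ 𝟙 y
      𝟙-mono {false}          _ = z≤n
      𝟙-mono {true}  {true}   _ = ≤-refl
      𝟙-mono {true}  {false}  f = contradiction tt f

      𝟙-mono-< : ∀ {x y} → T y → ¬ T x → 𝟙 x < 𝟙 y
      𝟙-mono-< {false} {true} _ _  = s≤s z≤n
      𝟙-mono-< {true}         _ ¬x = contradiction tt ¬x

    -- Every round that changes reach adds a vertex, so reach stabilises within n rounds.
    stable-or-grown : ∀ t → (∃[ t′ ] Stable t′) ⊎ suc t ≤ count t
    stable-or-grown zero = inj₂ (≤-trans (𝟙-mono (λ _ → reach-start 0)) (f≤sum (λ b → 𝟙 (reach 0 b)) s))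
    stable-or-grown (suc t) with stable-or-grown t | all? (λ b → T? (reach (suc t) b) →-dec T? (reach t b))
    ... | inj₁ st | _        = inj₁ st
    ... | inj₂ _  | yes st   = inj₁ (t , st)
    ... | inj₂ le | no ¬st   =
      let b , ¬b = ¬∀⟶∃¬ n _ (λ b → T? (reach (suc t) b) →-dec T? (reach t b)) ¬st
      in inj₂ (≤-trans (s≤s le) (sum-mono-< (λ b → 𝟙-mono (reach-mono t b)) b
                                   (𝟙-mono-< (new-witness b ¬b) (λ r → ¬b (λ _ → r)))))
      where
      new-witness : ∀ b → ¬ (T (reach (suc t) b) → T (reach t b)) → T (reach (suc t) b)
      new-witness b ¬b with reach (suc t) b
      ... | true  = tt
      ... | false = contradiction (λ ()) ¬b

    stabilises : ∃[ t ] Stable t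
    stabilises with stable-or-grown n
    ... | inj₁ st = st
    ... | inj₂ n<count = contradiction (≤-trans n<count (count≤n n)) (<-irrefl refl)
      where
      count≤n : ∀ t → count t ≤ n
      count≤n t = ≤-trans (sum-≤-const 1 (λ b → 𝟙≤1 (reach t b))) (≤-reflexive (*-identityʳ n))

    reach-or-closed : ∀ {p} (D : Fin n → Set p) → (∀ b → Dec (D b)) →
      (∃[ d ] D d × Star E s d) ⊎
      (Σ[ S ∈ (Fin n → Bool) ] T (S s) × (∀ {a b} → T (S a) → E a b → T (S b)) × (∀ b → T (S b) → ¬ D b))
    reach-or-closed D D? with stabilises
    ... | t , stable with any? (λ b → T? (reach t b) ×-dec D? b)
    ...   | yes (d , rd , Dd) = inj₁ (d , Dd , reach-path t d rd)
    ...   | no ¬found = inj₂ (reach t , reach-start t , (λ ra a→b → stable _ (reach-step t ra a→b)) ,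
                               λ b rb Db → ¬found (b , rb , Db))


module Rounding where

  open import Data.Nat
  open import Data.Nat.Properties
  open import Data.Nat.DivMod using (_/_; _%_; m≡m%n+[m/n]*n; m%n<n; m/n*n≤m)
  open import Data.Fin using (Fin; zero; suc)
  open import Data.Fin.Properties using (any?) renaming (_≟_ to _≟ᶠ_)
  open import Data.Bool using (Bool; true; false; T; not)
  open import Data.Product using (Σ-syntax; ∃-syntax; _×_; _,_; proj₁; proj₂)
  open import Data.Sum using (_⊎_; inj₁; inj₂)
  open import Function using (_∘_)
  open import Relation.Nullary using (Dec; yes; no; ¬_; contradiction; _×-dec_)
  open import Relation.Nullary.Decidable using (T?)
  open import Relation.Binary.PropositionalEquality
  open import Relation.Binary.Construct.Closure.ReflexiveTransitive using (Star; ε; _◅_)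
  open import Data.Nat.Solver using (module +-*-Solver)
  open +-*-Solver using (solve; _:*_; _:=_)
  open FinSum
  open Reachability

  vector-between : ∀ {n} (L U : Fin n → ℕ) r → (∀ j → L j ≤ U j) → sum L ≤ r → r ≤ sum U →
    Σ[ w ∈ (Fin n → ℕ) ] (∀ j → L j ≤ w j) × (∀ j → w j ≤ U j) × sum w ≡ r
  vector-between {zero}  L U r _   _    r≤0  = (λ ()) , (λ ()) , (λ ()) , sym (n≤0⇒n≡0 r≤0)
  vector-between {suc n} L U r L≤U ΣL≤r r≤ΣU = w , lower , upper , total
    where
    L′ U′ w₀ : ℕ
    L′ = sum (L ∘ suc)
    U′ = sum (U ∘ suc)
    w₀ = U zero ⊓ (r ∸ L′)

    w₀≤r : w₀ ≤ r
    w₀≤r = ≤-trans (m⊓n≤n (U zero) (r ∸ L′)) (m∸n≤m r L′)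

    L′≤r∸w₀ : L′ ≤ r ∸ w₀
    L′≤r∸w₀ = subst (_≤ r ∸ w₀) (m∸[m∸n]≡n (≤-trans (m≤n+m L′ (L zero)) ΣL≤r)) (∸-monoʳ-≤ r (m⊓n≤n (U zero) (r ∸ L′)))

    r∸w₀≤U′ : r ∸ w₀ ≤ U′
    r∸w₀≤U′ with ≤-total (U zero) (r ∸ L′)
    ... | inj₁ U₀≤ rewrite m≤n⇒m⊓n≡m U₀≤ = subst (r ∸ U zero ≤_) (m+n∸m≡n (U zero) U′) (∸-monoˡ-≤ (U zero) r≤ΣU)
    ... | inj₂ ≤U₀ rewrite m≥n⇒m⊓n≡n ≤U₀ =
      subst (_≤ U′) (sym (m∸[m∸n]≡n (≤-trans (m≤n+m L′ (L zero)) ΣL≤r))) (sum-mono-≤ (L≤U ∘ suc))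

    rest : Σ[ w′ ∈ (Fin n → ℕ) ] (∀ j → L (suc j) ≤ w′ j) × (∀ j → w′ j ≤ U (suc j)) × sum w′ ≡ r ∸ w₀
    rest = vector-between (L ∘ suc) (U ∘ suc) (r ∸ w₀) (L≤U ∘ suc) L′≤r∸w₀ r∸w₀≤U′

    w : Fin (suc n) → ℕ
    w zero    = w₀
    w (suc j) = proj₁ rest j

    lower : ∀ j → L j ≤ w j
    lower zero    = ⊓-glb (L≤U zero) (subst (_≤ r ∸ L′) (m+n∸n≡m (L zero) L′) (∸-monoˡ-≤ L′ ΣL≤r))
    lower (suc j) = proj₁ (proj₂ rest) j

    upper : ∀ j → w j ≤ U j
    upper zero    = m⊓n≤m (U zero) (r ∸ L′)
    upper (suc j) = proj₁ (proj₂ (proj₂ rest)) j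

    total : sum w ≡ r
    total = trans (cong (w₀ +_) (proj₂ (proj₂ (proj₂ rest)))) (m+[n∸m]≡n w₀≤r)

  ∣1+m-n∣≡1+∣m-n∣ : ∀ {m n} → n ≤ m → ∣ suc m - n ∣ ≡ suc ∣ m - n ∣
  ∣1+m-n∣≡1+∣m-n∣ {m} {zero}  _         = cong suc (sym (∣-∣-identityʳ m))
  ∣1+m-n∣≡1+∣m-n∣ {suc m} {suc n} (s≤s n≤m) = ∣1+m-n∣≡1+∣m-n∣ n≤m

  ∣m-n∣≡1+∣1+m-n∣ : ∀ {m n} → m < n → ∣ m - n ∣ ≡ suc ∣ suc m - n ∣
  ∣m-n∣≡1+∣1+m-n∣ {zero}  {suc n} _         = refl
  ∣m-n∣≡1+∣1+m-n∣ {suc m} {suc n} (s≤s m<n) = ∣m-n∣≡1+∣1+m-n∣ m<n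

  -- Q/k is a fractional solution of the transportation problem L ≤ W ≤ U with
  -- margins R, C. Starting from a row-feasible W, augment along paths of unit
  -- shifts between columns; if no deficient column is reachable from an excess
  -- one, the reachable columns form a closed set whose column total contradicts Q.
  module TransportRounding {m n : ℕ} (k : ℕ) .{{_ : NonZero k}}
    (L U Q : Fin m → Fin n → ℕ) (R : Fin m → ℕ) (C : Fin n → ℕ)
    (kL≤Q : ∀ i j → k * L i j ≤ Q i j) (Q≤kU : ∀ i j → Q i j ≤ k * U i j)
    (rowQ : ∀ i → sum (Q i) ≡ k * R i) (colQ : ∀ j → ∑[ i < m ] Q i j ≡ k * C j) where

    Mat : Set
    Mat = Fin m → Fin n → ℕ

    colSum : Mat → Fin n → ℕ
    colSum W j = ∑[ i < m ] W i j

    record RowFeasible (W : Mat) : Set where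
      field
        lower  : ∀ i j → L i j ≤ W i j
        upper  : ∀ i j → W i j ≤ U i j
        rowSum : ∀ i → sum (W i) ≡ R i
    open RowFeasible

    imbalance : Mat → ℕ
    imbalance W = ∑[ j < n ] ∣ colSum W j - C j ∣

    Excess Deficient : Mat → Fin n → Set
    Excess    W j = C j < colSum W j
    Deficient W j = colSum W j < C j

    CanShift : Mat → Fin m → Fin n → Fin n → Set
    CanShift W i a b = L i a < W i a × W i b < U i b

    Shift : Mat → Fin n → Fin n → Set
    Shift W a b = ∃[ i ] CanShift W i a b

    Shift? : ∀ W a b → Dec (Shift W a b)
    Shift? W a b = any? (λ i → (L i a <? W i a) ×-dec (W i b <? U i b))

    shift : Mat → Fin m → Fin n → Fin n → Mat
    shift W i₀ a b i j with i₀ ≟ᶠ i | a ≟ᶠ j | b ≟ᶠ j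
    ... | yes _ | yes _ | _     = pred (W i j)
    ... | yes _ | no _  | yes _ = suc (W i j)
    ... | _     | _     | _     = W i j

    module Shifted (W : Mat) (i₀ : Fin m) (a b : Fin n) (a≢b : a ≢ b) (canShift : CanShift W i₀ a b) where

      W′ : Mat
      W′ = shift W i₀ a b

      W′+δa≡W+δb : ∀ i j → W′ i j + δ i₀ i * δ a j ≡ W i j + δ i₀ i * δ b j
      W′+δa≡W+δb i j with i₀ ≟ᶠ i | a ≟ᶠ j | b ≟ᶠ j
      ... | yes refl | yes refl | yes refl = contradiction refl a≢b
      ... | yes refl | yes refl | no _     = trans (+-comm _ 1) (suc-pred′ (proj₁ canShift))
        where
        suc-pred′ : ∀ {x y} → x < y → suc (pred y) ≡ y + 0
        suc-pred′ {y = suc y} _ = cong suc (sym (+-identityʳ y))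
      ... | yes refl | no _     | yes refl = trans (+-identityʳ _) (+-comm 1 (W i j))
      ... | yes refl | no _     | no _     = refl
      ... | no _     | _        | _        = refl

      rowSum′ : ∀ i → sum (W′ i) ≡ sum (W i)
      rowSum′ i = +-cancelʳ-≡ (δ i₀ i) _ _ (begin
        sum (W′ i) + δ i₀ i                           ≡⟨ cong (sum (W′ i) +_) (one a) ⟨
        sum (W′ i) + ∑[ j < n ] (δ i₀ i * δ a j)         ≡⟨ ∑-distrib-+ (W′ i) _ ⟨
        ∑[ j < n ] (W′ i j + δ i₀ i * δ a j)           ≡⟨ sum-cong-≗ (W′+δa≡W+δb i) ⟩
        ∑[ j < n ] (W i j + δ i₀ i * δ b j)            ≡⟨ ∑-distrib-+ (W i) _ ⟩
        sum (W i) + ∑[ j < n ] (δ i₀ i * δ b j)          ≡⟨ cong (sum (W i) +_) (one b) ⟩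
        sum (W i) + δ i₀ i                            ∎)
        where
        open ≡-Reasoning
        one : ∀ c → ∑[ j < n ] (δ i₀ i * δ c j) ≡ δ i₀ i
        one c = trans (sum-*ˡ (δ i₀ i) (δ c)) (trans (cong (δ i₀ i *_) (sum-δ-count c)) (*-identityʳ _))

      colSum′ : ∀ j → colSum W′ j + δ a j ≡ colSum W j + δ b j
      colSum′ j = begin
        colSum W′ j + δ a j                          ≡⟨ cong (colSum W′ j +_) (one a) ⟨
        colSum W′ j + ∑[ i < m ] (δ i₀ i * δ a j)      ≡⟨ ∑-distrib-+ (λ i → W′ i j) _ ⟨
        ∑[ i < m ] (W′ i j + δ i₀ i * δ a j)         ≡⟨ sum-cong-≗ (λ i → W′+δa≡W+δb i j) ⟩
        ∑[ i < m ] (W i j + δ i₀ i * δ b j)          ≡⟨ ∑-distrib-+ (λ i → W i j) _ ⟩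
        colSum W j + ∑[ i < m ] (δ i₀ i * δ b j)       ≡⟨ cong (colSum W j +_) (one b) ⟩
        colSum W j + δ b j                           ∎
        where
        open ≡-Reasoning
        one : ∀ c → ∑[ i < m ] (δ i₀ i * δ c j) ≡ δ c j
        one c = trans (sum-*ʳ (δ c j) (δ i₀)) (trans (cong (_* δ c j) (sum-δ-count i₀)) (*-identityˡ _))

      private
        vanish : ∀ i x {c j : Fin n} → c ≢ j → x + δ i₀ i * δ c j ≡ x
        vanish i x c≢j = trans (cong (λ y → x + δ i₀ i * y) (δ-≢ c≢j)) (trans (cong (x +_) (*-zeroʳ (δ i₀ i))) (+-identityʳ x))

      W′≤W : ∀ i j → b ≢ j → W′ i j ≤ W i j
      W′≤W i j b≢j = subst (W′ i j ≤_) (trans (W′+δa≡W+δb i j) (vanish i (W i j) b≢j)) (m≤m+n _ _)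

      W≤W′ : ∀ i j → a ≢ j → W i j ≤ W′ i j
      W≤W′ i j a≢j = subst (W i j ≤_) (trans (sym (W′+δa≡W+δb i j)) (vanish i (W′ i j) a≢j)) (m≤m+n _ _)

      feasible : RowFeasible W → RowFeasible W′
      feasible V = record { lower = lower′ ; upper = upper′ ; rowSum = λ i → trans (rowSum′ i) (rowSum V i) }
        where
        lower′ : ∀ i j → L i j ≤ W′ i j
        lower′ i j with i₀ ≟ᶠ i | a ≟ᶠ j | b ≟ᶠ j
        ... | yes refl | yes refl | _        = pred-mono-≤ (proj₁ canShift)
        ... | yes refl | no _     | yes refl = ≤-trans (lower V i j) (n≤1+n _)
        ... | yes refl | no _     | no _     = lower V i j
        ... | no _     | _        | _        = lower V i j
        upper′ : ∀ i j → W′ i j ≤ U i j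
        upper′ i j with i₀ ≟ᶠ i | a ≟ᶠ j | b ≟ᶠ j
        ... | yes refl | yes refl | _        = ≤-trans pred[n]≤n (upper V i j)
        ... | yes refl | no _     | yes refl = proj₂ canShift
        ... | yes refl | no _     | no _     = upper V i j
        ... | no _     | _        | _        = upper V i j

      shift-preserved : ∀ {x y} → x ≢ a → y ≢ b → Shift W x y → Shift W′ x y
      shift-preserved {x} {y} x≢a y≢b (i , Lx<Wx , Wy<Uy) =
        i , <-≤-trans Lx<Wx (W≤W′ i x (≢-sym x≢a)) , ≤-<-trans (W′≤W i y (≢-sym y≢b)) Wy<Uy

      colSum-other : ∀ j → a ≢ j → b ≢ j → colSum W′ j ≡ colSum W j
      colSum-other j a≢j b≢j = +-cancelʳ-≡ 0 _ _ (trans (cong (colSum W′ j +_) (sym (δ-≢ a≢j)))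
                                               (trans (colSum′ j) (cong (colSum W j +_) (δ-≢ b≢j))))

      colSum-b : colSum W′ b ≡ suc (colSum W b)
      colSum-b = trans (sym (+-identityʳ _)) (trans (cong (colSum W′ b +_) (sym (δ-≢ a≢b)))
                       (trans (colSum′ b) (trans (cong (colSum W b +_) (δ-refl b)) (+-comm _ 1))))

      colSum-a : suc (colSum W′ a) ≡ colSum W a
      colSum-a = trans (+-comm 1 _) (trans (cong (colSum W′ a +_) (sym (δ-refl a)))
                       (trans (colSum′ a) (trans (cong (colSum W a +_) (δ-≢ (≢-sym a≢b))) (+-identityʳ _))))

      private
        D D′ : Fin n → ℕ
        D  j = ∣ colSum W  j - C j ∣
        D′ j = ∣ colSum W′ j - C j ∣

        D-a : Excess W a → D a ≡ suc (D′ a)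
        D-a exc = trans (cong (λ x → ∣ x - C a ∣) (sym colSum-a))
                        (∣1+m-n∣≡1+∣m-n∣ (≤-pred (subst (C a <_) (sym colSum-a) exc)))

        summed : ∀ (f g : Fin n → ℕ) c → (∀ j → f j + δ c j ≡ g j) → sum f + 1 ≡ sum g
        summed f g c f+δ≡g = trans (cong (sum f +_) (sym (sum-δ-count c)))
                                   (trans (sym (∑-distrib-+ f (δ c))) (sum-cong-≗ f+δ≡g))

      private
        column-cases : ∀ j → a ≡ j ⊎ b ≡ j ⊎ (a ≢ j × b ≢ j)
        column-cases j with a ≟ᶠ j | b ≟ᶠ j
        ... | yes a≡j | _        = inj₁ a≡j
        ... | no _    | yes b≡j  = inj₂ (inj₁ b≡j)
        ... | no a≢j  | no b≢j   = inj₂ (inj₂ (a≢j , b≢j))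

        D-other : ∀ j → a ≢ j → b ≢ j → D′ j ≡ D j
        D-other j a≢j b≢j = cong (λ x → ∣ x - C j ∣) (colSum-other j a≢j b≢j)

      imbalance-kept : Excess W a → ¬ Deficient W b → imbalance W′ ≡ imbalance W
      imbalance-kept exc ¬def = +-cancelʳ-≡ 1 _ _
        (trans (summed D′ (λ j → D j + δ b j) a per-column) (sym (summed D (λ j → D j + δ b j) b (λ _ → refl))))
        where
        per-column : ∀ j → D′ j + δ a j ≡ D j + δ b j
        per-column j with column-cases j
        ... | inj₁ refl = begin
          D′ a + δ a a  ≡⟨ cong (D′ a +_) (δ-refl a) ⟩
          D′ a + 1      ≡⟨ +-comm _ 1 ⟩
          suc (D′ a)    ≡⟨ D-a exc ⟨
          D a           ≡⟨ +-identityʳ _ ⟨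
          D a + 0       ≡⟨ cong (D a +_) (δ-≢ (≢-sym a≢b)) ⟨
          D a + δ b a   ∎
          where open ≡-Reasoning
        ... | inj₂ (inj₁ refl) = begin
          D′ b + δ a b  ≡⟨ cong (D′ b +_) (δ-≢ a≢b) ⟩
          D′ b + 0      ≡⟨ +-identityʳ _ ⟩
          D′ b          ≡⟨ cong (λ x → ∣ x - C b ∣) colSum-b ⟩
          ∣ suc (colSum W b) - C b ∣ ≡⟨ ∣1+m-n∣≡1+∣m-n∣ (≮⇒≥ ¬def) ⟩
          suc (D b)     ≡⟨ +-comm 1 _ ⟩
          D b + 1       ≡⟨ cong (D b +_) (δ-refl b) ⟨
          D b + δ b b   ∎
          where open ≡-Reasoning
        ... | inj₂ (inj₂ (a≢j , b≢j)) =
          cong₂ _+_ (D-other j a≢j b≢j) (trans (δ-≢ a≢j) (sym (δ-≢ b≢j)))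

      imbalance-drops : Excess W a → Deficient W b → imbalance W′ < imbalance W
      imbalance-drops exc def = subst (_< imbalance W) (+-identityʳ _) chain
        where
        per-column : ∀ j → D′ j + δ a j + δ b j ≡ D j
        per-column j with column-cases j
        ... | inj₁ refl = begin
          D′ a + δ a a + δ b a ≡⟨ cong₂ (λ x y → D′ a + x + y) (δ-refl a) (δ-≢ (≢-sym a≢b)) ⟩
          D′ a + 1 + 0         ≡⟨ trans (+-identityʳ _) (+-comm _ 1) ⟩
          suc (D′ a)           ≡⟨ D-a exc ⟨
          D a                  ∎
          where open ≡-Reasoning
        ... | inj₂ (inj₁ refl) = begin
          D′ b + δ a b + δ b b ≡⟨ cong₂ (λ x y → D′ b + x + y) (δ-≢ a≢b) (δ-refl b) ⟩
          D′ b + 0 + 1         ≡⟨ trans (cong (_+ 1) (+-identityʳ _)) (+-comm _ 1) ⟩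
          suc (D′ b)           ≡⟨ cong (λ x → suc ∣ x - C b ∣) colSum-b ⟩
          suc ∣ suc (colSum W b) - C b ∣ ≡⟨ ∣m-n∣≡1+∣1+m-n∣ def ⟨
          D b                  ∎
          where open ≡-Reasoning
        ... | inj₂ (inj₂ (a≢j , b≢j)) = begin
          D′ j + δ a j + δ b j ≡⟨ cong₂ (λ x y → D′ j + x + y) (δ-≢ a≢j) (δ-≢ b≢j) ⟩
          D′ j + 0 + 0         ≡⟨ trans (+-identityʳ _) (+-identityʳ _) ⟩
          D′ j                 ≡⟨ D-other j a≢j b≢j ⟩
          D j                  ∎
          where open ≡-Reasoning
        chain : imbalance W′ + 0 < imbalance W
        chain = begin-strict
          imbalance W′ + 0              <⟨ +-monoʳ-< (imbalance W′) (s≤s z≤n) ⟩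
          imbalance W′ + 2              ≡⟨ +-assoc (imbalance W′) 1 1 ⟨
          imbalance W′ + 1 + 1          ≡⟨ cong (_+ 1) (summed D′ (λ j → D′ j + δ a j) a (λ _ → refl)) ⟩
          ∑[ j < n ] (D′ j + δ a j) + 1 ≡⟨ summed (λ j → D′ j + δ a j) D b per-column ⟩
          imbalance W                   ∎
          where open ≤-Reasoning

    augment : ∀ fuel W → RowFeasible W → ∀ {a d} (p : Star (Shift W) a d) → length p ≤ fuel →
              Excess W a → Deficient W d → ∃[ W′ ] RowFeasible W′ × imbalance W′ < imbalance W
    augment _ W V ε _ exc def = contradiction exc (<-asym def)
    augment (suc fuel) W V {a} {d} (_◅_ {j = b} (i , can) p) (s≤s |p|≤fuel) exc def
      with colSum W b <? C b
    ... | yes def-b = W′ , feasible V , imbalance-drops exc def-b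
      where
      a≢b : a ≢ b
      a≢b refl = <-asym exc def-b
      open Shifted W i a b a≢b can
    ... | no ¬def-b with a ≟ᶠ b
    ...   | yes refl = augment fuel W V p |p|≤fuel exc def
    ...   | no a≢b with shortcut a p
    ...     | inj₂ (q , q<p) = augment fuel W V q (≤-trans (<⇒≤ q<p) |p|≤fuel) exc def
    ...     | inj₁ a∉p with shortcut b p
    ...       | inj₂ (q , q<p) = augment fuel W V ((i , can) ◅ q) (≤-trans q<p |p|≤fuel) exc def
    ...       | inj₁ b∉p =
      let p′ , |p′|≡|p| = transport a b shift-preserved p (≢-sym a≢b) a∉p b∉p
          exc-b : Excess W′ b
          exc-b = subst (C b <_) (sym colSum-b) (s≤s (≮⇒≥ ¬def-b))
          def-d : Deficient W′ d
          def-d = subst (_< C d) (sym (colSum-other d (λ { refl → <-asym exc def }) (λ { refl → ¬def-b def }))) def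
          W″ , V″ , Φ″<Φ′ = augment fuel W′ (feasible V) p′ (subst (_≤ fuel) (sym |p′|≡|p|) |p|≤fuel) exc-b def-d
      in W″ , V″ , subst (imbalance W″ <_) (imbalance-kept exc ¬def-b) Φ″<Φ′
      where open Shifted W i a b a≢b can

    private
      kR≡ΣQ : ∀ i → k * R i ≡ sum (Q i)
      kR≡ΣQ i = sym (rowQ i)

    ΣR≡ΣC : sum R ≡ sum C
    ΣR≡ΣC = *-cancelˡ-≡ (sum R) (sum C) k (begin
      k * sum R                  ≡⟨ sum-*ˡ k R ⟨
      ∑[ i < m ] (k * R i)       ≡⟨ sum-cong-≗ (λ i → sym (rowQ i)) ⟩
      ∑[ i < m ] sum (Q i)       ≡⟨ ∑-comm Q ⟩
      ∑[ j < n ] colSum Q j      ≡⟨ sum-cong-≗ colQ ⟩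
      ∑[ j < n ] (k * C j)       ≡⟨ sum-*ˡ k C ⟩
      k * sum C                  ∎)
      where open ≡-Reasoning

    sum-colSum : ∀ {W} → RowFeasible W → sum (colSum W) ≡ sum R
    sum-colSum {W} V = trans (sym (∑-comm W)) (sum-cong-≗ (rowSum V))

    no-excess⇒balanced : ∀ {W} → RowFeasible W → (∀ j → ¬ Excess W j) → ∀ j → colSum W j ≡ C j
    no-excess⇒balanced {W} V ¬exc j = ≤-antisym (≮⇒≥ (¬exc j)) (≮⇒≥ deficient-impossible)
      where
      deficient-impossible : ¬ Deficient W j
      deficient-impossible def = <-irrefl (trans (sum-colSum V) ΣR≡ΣC)
                                          (sum-mono-< (λ j′ → ≮⇒≥ (¬exc j′)) j def)

    -- If an entry of row i inside S can still decrease, closedness puts every entry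
    -- outside S at its upper bound; otherwise every entry inside S is at its lower bound.
    closed-row-bound : ∀ {W} → RowFeasible W → (S : Fin n → Bool) →
      (∀ {a b} → T (S a) → Shift W a b → T (S b)) →
      ∀ i → k * ∑[ j < n ] (𝟙 (S j) * W i j) ≤ ∑[ j < n ] (𝟙 (S j) * Q i j)
    closed-row-bound {W} V S closed i with any? (λ a → T? (S a) ×-dec (L i a <? W i a))
    ... | yes (a , Sa , La<Wa) = +-cancelʳ-≤ Qout (k * Win) Qin (begin
        k * Win + Qout                ≤⟨ +-monoʳ-≤ (k * Win) (sum-mono-≤ outside) ⟩
        k * Win + ∑[ j < n ] (𝟙 (not (S j)) * (k * W i j))
          ≡⟨ cong (k * Win +_) (trans (sum-cong-≗ (λ j → solve 3 (λ s k w → s :* (k :* w) := k :* (s :* w)) refl (𝟙 (not (S j))) k (W i j)))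
                                      (sum-*ˡ k (λ j → 𝟙 (not (S j)) * W i j))) ⟩
        k * Win + k * Wout            ≡⟨ *-distribˡ-+ k Win Wout ⟨
        k * (Win + Wout)              ≡⟨ cong (k *_) (sym (sum-split-𝟙 S (W i))) ⟩
        k * sum (W i)                 ≡⟨ cong (k *_) (rowSum V i) ⟩
        k * R i                       ≡⟨ kR≡ΣQ i ⟩
        sum (Q i)                     ≡⟨ sum-split-𝟙 S (Q i) ⟩
        Qin + Qout                    ∎)
      where
      open ≤-Reasoning
      Win Wout Qin Qout : ℕ
      Win  = ∑[ j < n ] (𝟙 (S j) * W i j)
      Wout = ∑[ j < n ] (𝟙 (not (S j)) * W i j)
      Qin  = ∑[ j < n ] (𝟙 (S j) * Q i j)
      Qout = ∑[ j < n ] (𝟙 (not (S j)) * Q i j)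
      outside : ∀ j → 𝟙 (not (S j)) * Q i j ≤ 𝟙 (not (S j)) * (k * W i j)
      outside j with S j in Sj
      ... | true  = z≤n
      ... | false = *-monoʳ-≤ 1 (≤-trans (Q≤kU i j) (*-monoʳ-≤ k (≮⇒≥ λ Wij<Uij →
                      subst T Sj (closed Sa (i , La<Wa , Wij<Uij)))))
    ... | no ¬lifted = ≤-trans (≤-reflexive (sym (sum-*ˡ k (λ j → 𝟙 (S j) * W i j)))) (sum-mono-≤ inside)
      where
      inside : ∀ j → k * (𝟙 (S j) * W i j) ≤ 𝟙 (S j) * Q i j
      inside j with S j in Sj
      ... | false = ≤-reflexive (*-zeroʳ k)
      ... | true  = subst₂ _≤_ (cong (k *_) (sym (+-identityʳ _))) (sym (+-identityʳ _))
                      (≤-trans (*-monoʳ-≤ k (≮⇒≥ λ Lij<Wij → ¬lifted (j , subst T (sym Sj) _ , Lij<Wij))) (kL≤Q i j))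

    closed⇒¬excess : ∀ {W} → RowFeasible W → (S : Fin n → Bool) →
      (∀ {a b} → T (S a) → Shift W a b → T (S b)) → (∀ j → T (S j) → ¬ Deficient W j) →
      ∀ j₀ → T (S j₀) → ¬ Excess W j₀
    closed⇒¬excess {W} V S closed ¬def j₀ Sj₀ exc = <⇒≱ (sum-mono-< target≤col j₀ target<col) col≤target
      where
      target≤col : ∀ j → 𝟙 (S j) * C j ≤ 𝟙 (S j) * colSum W j
      target≤col j with S j in Sj
      ... | false = z≤n
      ... | true  = *-monoʳ-≤ 1 (≮⇒≥ (¬def j (subst T (sym Sj) _)))
      target<col : 𝟙 (S j₀) * C j₀ < 𝟙 (S j₀) * colSum W j₀
      target<col = positive (S j₀) Sj₀
        where
        positive : ∀ b → T b → 𝟙 b * C j₀ < 𝟙 b * colSum W j₀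
        positive true _ = *-monoʳ-< 1 exc
      col≤target : ∑[ j < n ] (𝟙 (S j) * colSum W j) ≤ ∑[ j < n ] (𝟙 (S j) * C j)
      col≤target = *-cancelˡ-≤ k (begin
        k * ∑[ j < n ] (𝟙 (S j) * colSum W j)          ≡⟨ cong (k *_) (sum-cong-≗ (λ j → sym (sum-*ˡ (𝟙 (S j)) (λ i → W i j)))) ⟩
        k * ∑[ j < n ] ∑[ i < m ] (𝟙 (S j) * W i j)    ≡⟨ cong (k *_) (∑-comm (λ j i → 𝟙 (S j) * W i j)) ⟩
        k * ∑[ i < m ] ∑[ j < n ] (𝟙 (S j) * W i j)    ≡⟨ sum-*ˡ k (λ i → ∑[ j < n ] (𝟙 (S j) * W i j)) ⟨
        ∑[ i < m ] (k * ∑[ j < n ] (𝟙 (S j) * W i j))  ≤⟨ sum-mono-≤ (closed-row-bound V S closed) ⟩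
        ∑[ i < m ] ∑[ j < n ] (𝟙 (S j) * Q i j)        ≡⟨ ∑-comm (λ i j → 𝟙 (S j) * Q i j) ⟩
        ∑[ j < n ] ∑[ i < m ] (𝟙 (S j) * Q i j)
          ≡⟨ sum-cong-≗ (λ j → trans (sum-*ˡ (𝟙 (S j)) (λ i → Q i j)) (cong (𝟙 (S j) *_) (colQ j))) ⟩
        ∑[ j < n ] (𝟙 (S j) * (k * C j))
          ≡⟨ sum-cong-≗ (λ j → solve 3 (λ s k c → s :* (k :* c) := k :* (s :* c)) refl (𝟙 (S j)) k (C j)) ⟩
        ∑[ j < n ] (k * (𝟙 (S j) * C j))              ≡⟨ sum-*ˡ k (λ j → 𝟙 (S j) * C j) ⟩
        k * ∑[ j < n ] (𝟙 (S j) * C j)                ∎)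
        where open ≤-Reasoning

    balance : ∀ fuel W → RowFeasible W → imbalance W ≤ fuel → ∃[ W′ ] RowFeasible W′ × (∀ j → colSum W′ j ≡ C j)
    balance fuel W V Φ≤fuel with any? (λ j → C j <? colSum W j)
    ... | no ¬exc = W , V , no-excess⇒balanced V (λ j exc → ¬exc (j , exc))
    ... | yes (j₀ , exc) with Closure.reach-or-closed (Shift W) (Shift? W) j₀ (Deficient W) (λ j → colSum W j <? C j)
    ...   | inj₂ (S , Sj₀ , closed , ¬def) = contradiction exc (closed⇒¬excess V S closed ¬def j₀ Sj₀)
    ...   | inj₁ (d , def , p) with augment (length p) W V p ≤-refl exc def | fuel
    ...     | W′ , V′ , Φ′<Φ | suc fuel′ = balance fuel′ W′ V′ (≤-pred (≤-trans Φ′<Φ Φ≤fuel))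
    ...     | _  , _  , Φ′<Φ | zero      = contradiction (≤-trans Φ′<Φ Φ≤fuel) λ ()

    row-feasible : ∃[ W ] RowFeasible W
    row-feasible = (λ i → proj₁ (row i)) , record
      { lower  = λ i → proj₁ (proj₂ (row i))
      ; upper  = λ i → proj₁ (proj₂ (proj₂ (row i)))
      ; rowSum = λ i → proj₂ (proj₂ (proj₂ (row i))) }
      where
      row : ∀ i → Σ[ w ∈ (Fin n → ℕ) ] (∀ j → L i j ≤ w j) × (∀ j → w j ≤ U i j) × sum w ≡ R i
      row i = vector-between (L i) (U i) (R i)
        (λ j → *-cancelˡ-≤ k (≤-trans (kL≤Q i j) (Q≤kU i j)))
        (*-cancelˡ-≤ k (≤-trans (≤-reflexive (sym (sum-*ˡ k (L i)))) (≤-trans (sum-mono-≤ (kL≤Q i)) (≤-reflexive (rowQ i)))))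
        (*-cancelˡ-≤ k (≤-trans (≤-reflexive (sym (rowQ i))) (≤-trans (sum-mono-≤ (Q≤kU i)) (≤-reflexive (sum-*ˡ k (U i))))))

    rounding : ∃[ W ] (∀ i j → L i j ≤ W i j) × (∀ i j → W i j ≤ U i j) ×
                      (∀ i → sum (W i) ≡ R i) × (∀ j → colSum W j ≡ C j)
    rounding =
      let W₀ , V₀ = row-feasible
          W , V , cols = balance (imbalance W₀) W₀ V₀ ≤-refl
      in W , lower V , upper V , rowSum V , cols

  record Rescaled (k k′ y y′ : ℕ) : Set where
    field
      upper : y′ * k ≤ y * k′ + k
      lower : y * k′ ≤ y′ * k + k
      zero-preserving : y ≡ 0 → y′ ≡ 0

  module _ (k k′ : ℕ) .{{_ : NonZero k}} where

    private
      ⌊_⌋ : ℕ → ℕ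
      ⌊ y ⌋ = (y * k′) / k

      -- an upper bound for y k′ / k that vanishes together with y
      ⌈_⌉ : ℕ → ℕ
      ⌈ zero  ⌉ = 0
      ⌈ suc y ⌉ = suc ⌊ suc y ⌋

      k⌊y⌋≤yk′ : ∀ y → k * ⌊ y ⌋ ≤ y * k′
      k⌊y⌋≤yk′ y = subst (_≤ y * k′) (*-comm ⌊ y ⌋ k) (m/n*n≤m (y * k′) k)

      yk′<k[1+⌊y⌋] : ∀ y → y * k′ < k * suc ⌊ y ⌋
      yk′<k[1+⌊y⌋] y = subst₂ _<_ (sym (m≡m%n+[m/n]*n (y * k′) k))
                                 (trans (cong (k +_) (*-comm ⌊ y ⌋ k)) (sym (*-suc k ⌊ y ⌋)))
                                 (+-monoˡ-< (⌊ y ⌋ * k) (m%n<n (y * k′) k))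

      yk′≤k⌈y⌉ : ∀ y → y * k′ ≤ k * ⌈ y ⌉
      yk′≤k⌈y⌉ zero    = z≤n
      yk′≤k⌈y⌉ (suc y) = <⇒≤ (yk′<k[1+⌊y⌋] (suc y))

      ⌈y⌉≤1+⌊y⌋ : ∀ y → ⌈ y ⌉ ≤ suc ⌊ y ⌋
      ⌈y⌉≤1+⌊y⌋ zero    = z≤n
      ⌈y⌉≤1+⌊y⌋ (suc y) = ≤-refl

      rescaled-between : ∀ y w → ⌊ y ⌋ ≤ w → w ≤ ⌈ y ⌉ → Rescaled k k′ y w
      rescaled-between y w ⌊y⌋≤w w≤⌈y⌉ = record
        { upper = begin
            w * k              ≤⟨ *-monoˡ-≤ k (≤-trans w≤⌈y⌉ (⌈y⌉≤1+⌊y⌋ y)) ⟩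
            suc ⌊ y ⌋ * k      ≡⟨ +-comm k (⌊ y ⌋ * k) ⟩
            ⌊ y ⌋ * k + k      ≤⟨ +-monoˡ-≤ k (subst (_≤ y * k′) (*-comm k ⌊ y ⌋) (k⌊y⌋≤yk′ y)) ⟩
            y * k′ + k         ∎
        ; lower = begin
            y * k′             ≤⟨ <⇒≤ (yk′<k[1+⌊y⌋] y) ⟩
            k * suc ⌊ y ⌋      ≡⟨ trans (*-comm k (suc ⌊ y ⌋)) (+-comm k (⌊ y ⌋ * k)) ⟩
            ⌊ y ⌋ * k + k      ≤⟨ +-monoˡ-≤ k (*-monoˡ-≤ k ⌊y⌋≤w) ⟩
            w * k + k          ∎
        ; zero-preserving = λ { refl → n≤0⇒n≡0 w≤⌈y⌉ }
        }
        where open ≤-Reasoning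

    rescale : ∀ {m n} (Y : Fin m → Fin n → ℕ) (R : Fin m → ℕ) (C : Fin n → ℕ) →
      (∀ i → sum (Y i) ≡ k * R i) → (∀ j → ∑[ i < m ] Y i j ≡ k * C j) →
      Σ[ Y′ ∈ (Fin m → Fin n → ℕ) ] (∀ i → sum (Y′ i) ≡ k′ * R i) × (∀ j → ∑[ i < m ] Y′ i j ≡ k′ * C j) ×
                                     (∀ i j → Rescaled k k′ (Y i j) (Y′ i j))
    rescale {m} {n} Y R C rowY colY =
      let Y′ , lower , upper , rows , cols = TransportRounding.rounding k (λ i j → ⌊ Y i j ⌋) (λ i j → ⌈ Y i j ⌉)
                                               (λ i j → Y i j * k′) (λ i → k′ * R i) (λ j → k′ * C j)
                                               (λ i j → k⌊y⌋≤yk′ (Y i j)) (λ i j → yk′≤k⌈y⌉ (Y i j)) rowQ colQ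
      in Y′ , rows , cols , λ i j → rescaled-between (Y i j) (Y′ i j) (lower i j) (upper i j)
      where
      scaled : ∀ {l} (f : Fin l → ℕ) r → sum f ≡ k * r → ∑[ i < l ] (f i * k′) ≡ k * (k′ * r)
      scaled f r Σf≡kr = begin
        ∑[ i < _ ] (f i * k′)  ≡⟨ sum-*ʳ k′ f ⟩
        sum f * k′             ≡⟨ cong (_* k′) Σf≡kr ⟩
        k * r * k′             ≡⟨ *-assoc k r k′ ⟩
        k * (r * k′)           ≡⟨ cong (k *_) (*-comm r k′) ⟩
        k * (k′ * r)           ∎
        where open ≡-Reasoning
      rowQ : ∀ i → ∑[ j < n ] (Y i j * k′) ≡ k * (k′ * R i)
      rowQ i = scaled (Y i) (R i) (rowY i)
      colQ : ∀ j → ∑[ i < m ] (Y i j * k′) ≡ k * (k′ * C j)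
      colQ j = scaled (λ i → Y i j) (C j) (colY j)


module Rational where

  open import Data.Nat as ℕ using (ℕ; zero; suc; z≤n)
  import Data.Nat.Properties as ℕ
  import Data.Integer as ℤ
  import Data.Integer.Properties as ℤ
  open import Data.Rational
  open import Data.Rational.Properties
  import Data.Rational.Unnormalised as ℚᵘ
  import Data.Rational.Unnormalised.Properties as ℚᵘ
  open import Data.Nat.Coprimality using (1-coprimeTo) renaming (sym to coprime-sym)
  open import Data.Fin using (Fin; zero; suc)
  open import Data.Sum using (inj₁; inj₂)
  open import Function using (_∘_)
  open import Relation.Binary.PropositionalEquality
  open import Algebra.Bundles using (CommutativeRing)
  import Algebra.Properties.Semiring.Sum as SemiringSum
  module ℕSum = FinSum
  open import Data.Rational.Solver using (module +-*-Solver)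
  import Data.Nat.Solver
  open import Data.Product using (∃-syntax; _,_)
  open import Relation.Nullary using (contradiction)
  open import Defs using (Σℚ; recipℕ)

  fromℕ : ℕ → ℚ
  fromℕ n = mkℚ (ℤ.+ n) 0 (coprime-sym (1-coprimeTo n))

  fromℕ-+ : ∀ a b → fromℕ (a ℕ.+ b) ≡ fromℕ a + fromℕ b
  fromℕ-+ a b = toℚᵘ-injective (ℚᵘ.≃-trans (ℚᵘ.*≡* eq) (ℚᵘ.≃-sym (toℚᵘ-homo-+ (fromℕ a) (fromℕ b))))
    where
    eq : (ℤ.+ (a ℕ.+ b)) ℤ.* (ℤ.+ 1) ≡ ((ℤ.+ a) ℤ.* (ℤ.+ 1) ℤ.+ (ℤ.+ b) ℤ.* (ℤ.+ 1)) ℤ.* (ℤ.+ 1)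
    eq rewrite ℤ.*-identityʳ (ℤ.+ (a ℕ.+ b)) | ℤ.*-identityʳ (ℤ.+ a) | ℤ.*-identityʳ (ℤ.+ b)
             | ℤ.*-identityʳ (ℤ.+ a ℤ.+ ℤ.+ b) = ℤ.pos-+ a b

  fromℕ-mono-≤ : ∀ {a b} → a ℕ.≤ b → fromℕ a ≤ fromℕ b
  fromℕ-mono-≤ {a} {b} a≤b = *≤* (subst₂ ℤ._≤_ (sym (ℤ.*-identityʳ (ℤ.+ a))) (sym (ℤ.*-identityʳ (ℤ.+ b))) (ℤ.+≤+ a≤b))

  0≤fromℕ : ∀ a → 0ℚ ≤ fromℕ a
  0≤fromℕ a = fromℕ-mono-≤ z≤n

  open +-*-Solver

  fromℕ-∸ : ∀ {a b} → b ℕ.≤ a → fromℕ a - fromℕ b ≡ fromℕ (a ℕ.∸ b)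
  fromℕ-∸ {a} {b} b≤a = begin
    fromℕ a - fromℕ b                      ≡⟨ cong (λ x → fromℕ x - fromℕ b) (ℕ.m∸n+n≡m b≤a) ⟨
    fromℕ (a ℕ.∸ b ℕ.+ b) - fromℕ b        ≡⟨ cong (_- fromℕ b) (fromℕ-+ (a ℕ.∸ b) b) ⟩
    fromℕ (a ℕ.∸ b) + fromℕ b - fromℕ b    ≡⟨ solve 2 (λ x y → (x :+ y) :- y := x) refl (fromℕ (a ℕ.∸ b)) (fromℕ b) ⟩
    fromℕ (a ℕ.∸ b)                        ∎
    where open ≡-Reasoning

  ∣fromℕ-fromℕ∣ : ∀ a b → ∣ fromℕ a - fromℕ b ∣ ≡ fromℕ ℕ.∣ a - b ∣
  ∣fromℕ-fromℕ∣ a b with ℕ.≤-total b a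
  ... | inj₁ b≤a = trans (cong ∣_∣ (fromℕ-∸ b≤a))
                         (trans (0≤p⇒∣p∣≡p (0≤fromℕ _)) (cong fromℕ (sym (ℕ.m≤n⇒∣n-m∣≡n∸m b≤a))))
  ... | inj₂ a≤b = begin
    ∣ fromℕ a - fromℕ b ∣       ≡⟨ cong ∣_∣ (solve 2 (λ x y → x :- y := :- (y :- x)) refl (fromℕ a) (fromℕ b)) ⟩
    ∣ - (fromℕ b - fromℕ a) ∣   ≡⟨ ∣-p∣≡∣p∣ _ ⟩
    ∣ fromℕ b - fromℕ a ∣       ≡⟨ cong ∣_∣ (fromℕ-∸ a≤b) ⟩
    ∣ fromℕ (b ℕ.∸ a) ∣         ≡⟨ 0≤p⇒∣p∣≡p (0≤fromℕ _) ⟩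
    fromℕ (b ℕ.∸ a)             ≡⟨ cong fromℕ (trans (sym (ℕ.m≤n⇒∣n-m∣≡n∸m a≤b)) (ℕ.∣-∣-comm b a)) ⟩
    fromℕ ℕ.∣ a - b ∣           ∎
    where open ≡-Reasoning

  private
    module ℚSum = SemiringSum (CommutativeRing.semiring +-*-commutativeRing)

  Σℚ≡sum : ∀ {n} (f : Fin n → ℚ) → Σℚ f ≡ ℚSum.sum f
  Σℚ≡sum {zero}  f = refl
  Σℚ≡sum {suc n} f = cong (f zero +_) (Σℚ≡sum (f ∘ suc))

  Σℚ-cong : ∀ {n} {f g : Fin n → ℚ} → (∀ i → f i ≡ g i) → Σℚ f ≡ Σℚ g
  Σℚ-cong {f = f} {g} f≗g = trans (Σℚ≡sum f) (trans (ℚSum.sum-cong-≗ f≗g) (sym (Σℚ≡sum g)))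

  Σℚ-fromℕ : ∀ {n} (f : Fin n → ℕ) → Σℚ (λ i → fromℕ (f i)) ≡ fromℕ (ℕSum.sum f)
  Σℚ-fromℕ {zero}  f = refl
  Σℚ-fromℕ {suc n} f = trans (cong (fromℕ (f zero) +_) (Σℚ-fromℕ (f ∘ suc))) (sym (fromℕ-+ (f zero) _))

  Σℚ-+ : ∀ {n} (f g : Fin n → ℚ) → Σℚ (λ i → f i + g i) ≡ Σℚ f + Σℚ g
  Σℚ-+ f g = begin
    Σℚ (λ i → f i + g i)           ≡⟨ Σℚ≡sum (λ i → f i + g i) ⟩
    ℚSum.sum (λ i → f i + g i)     ≡⟨ ℚSum.∑-distrib-+ f g ⟩
    ℚSum.sum f + ℚSum.sum g        ≡⟨ cong₂ _+_ (Σℚ≡sum f) (Σℚ≡sum g) ⟨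
    Σℚ f + Σℚ g                    ∎
    where open ≡-Reasoning

  Σℚ-neg : ∀ {n} (f : Fin n → ℚ) → Σℚ (λ i → - f i) ≡ - Σℚ f
  Σℚ-neg {zero}  f = refl
  Σℚ-neg {suc n} f = trans (cong (- f zero +_) (Σℚ-neg (f ∘ suc))) (sym (neg-distrib-+ (f zero) _))

  Σℚ-sub : ∀ {n} (f g : Fin n → ℚ) → Σℚ (λ i → f i - g i) ≡ Σℚ f - Σℚ g
  Σℚ-sub f g = trans (Σℚ-+ f (λ i → - g i)) (cong (Σℚ f +_) (Σℚ-neg g))

  Σℚ-*ˡ : ∀ {n} c (f : Fin n → ℚ) → Σℚ (λ i → c * f i) ≡ c * Σℚ f
  Σℚ-*ˡ c f = trans (Σℚ≡sum (λ i → c * f i)) (trans (sym (ℚSum.*-distribˡ-sum c f)) (cong (c *_) (sym (Σℚ≡sum f))))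

  Σℚ-*ʳ : ∀ {n} c (f : Fin n → ℚ) → Σℚ (λ i → f i * c) ≡ Σℚ f * c
  Σℚ-*ʳ c f = trans (Σℚ≡sum (λ i → f i * c)) (trans (sym (ℚSum.*-distribʳ-sum c f)) (cong (_* c) (sym (Σℚ≡sum f))))

  Σℚ-comm : ∀ {m n} (f : Fin m → Fin n → ℚ) → Σℚ (λ i → Σℚ (f i)) ≡ Σℚ (λ j → Σℚ (λ i → f i j))
  Σℚ-comm f = begin
    Σℚ (λ i → Σℚ (f i))                      ≡⟨ trans (Σℚ≡sum (λ i → Σℚ (f i))) (ℚSum.sum-cong-≗ (λ i → Σℚ≡sum (f i))) ⟩
    ℚSum.sum (λ i → ℚSum.sum (f i))          ≡⟨ ℚSum.∑-comm f ⟩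
    ℚSum.sum (λ j → ℚSum.sum (λ i → f i j))  ≡⟨ trans (Σℚ≡sum (λ j → Σℚ (λ i → f i j))) (ℚSum.sum-cong-≗ (λ j → Σℚ≡sum (λ i → f i j))) ⟨
    Σℚ (λ j → Σℚ (λ i → f i j))              ∎
    where open ≡-Reasoning

  Σℚ-mono-≤ : ∀ {n} {f g : Fin n → ℚ} → (∀ i → f i ≤ g i) → Σℚ f ≤ Σℚ g
  Σℚ-mono-≤ {zero}  f≤g = ≤-refl
  Σℚ-mono-≤ {suc n} f≤g = +-mono-≤ (f≤g zero) (Σℚ-mono-≤ (f≤g ∘ suc))

  ∣Σℚ∣≤Σℚ∣∣ : ∀ {n} (f : Fin n → ℚ) → ∣ Σℚ f ∣ ≤ Σℚ (λ i → ∣ f i ∣)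
  ∣Σℚ∣≤Σℚ∣∣ {zero}  f = ≤-refl
  ∣Σℚ∣≤Σℚ∣∣ {suc n} f = ≤-trans (∣p+q∣≤∣p∣+∣q∣ (f zero) _) (+-monoʳ-≤ ∣ f zero ∣ (∣Σℚ∣≤Σℚ∣∣ (f ∘ suc)))

  0≤recipℕ : ∀ N → 0ℚ ≤ recipℕ N
  0≤recipℕ zero    = ≤-refl
  0≤recipℕ (suc N) = nonNegative⁻¹ _ {{normalize-nonNeg 1 (suc N)}}

  frac : ℕ → ℕ → ℚ
  frac a b = fromℕ a * recipℕ b

  private
    frac≃mkℚᵘ : ∀ a b → toℚᵘ (frac a (suc b)) ℚᵘ.≃ ℚᵘ.mkℚᵘ (ℤ.+ a) b
    frac≃mkℚᵘ a b = ℚᵘ.≃-trans (toℚᵘ-homo-* (fromℕ a) (recipℕ (suc b)))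
      (ℚᵘ.≃-trans (ℚᵘ.*-cong (ℚᵘ.≃-refl {toℚᵘ (fromℕ a)}) (toℚᵘ-fromℚᵘ (ℚᵘ.mkℚᵘ (ℤ.+ 1) b))) (ℚᵘ.*≡* eq))
      where
      eq : ((ℤ.+ a) ℤ.* (ℤ.+ 1)) ℤ.* (ℤ.+ suc b) ≡ (ℤ.+ a) ℤ.* (ℤ.+ suc (b ℕ.+ 0))
      eq rewrite ℤ.*-identityʳ (ℤ.+ a) | ℕ.+-identityʳ b = refl

  frac-mono-≤ : ∀ a b c d .{{_ : ℕ.NonZero b}} .{{_ : ℕ.NonZero d}} → a ℕ.* d ℕ.≤ c ℕ.* b → frac a b ≤ frac c d
  frac-mono-≤ a (suc b) c (suc d) ad≤cb =
    toℚᵘ-cancel-≤ (ℚᵘ.≤-respˡ-≃ (ℚᵘ.≃-sym (frac≃mkℚᵘ a b)) (ℚᵘ.≤-respʳ-≃ (ℚᵘ.≃-sym (frac≃mkℚᵘ c d))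
      (ℚᵘ.*≤* (subst₂ ℤ._≤_ (ℤ.pos-* a (suc d)) (ℤ.pos-* c (suc b)) (ℤ.+≤+ ad≤cb)))))

  frac-+ : ∀ a b c d .{{_ : ℕ.NonZero b}} .{{_ : ℕ.NonZero d}} → frac a b + frac c d ≡ frac (a ℕ.* d ℕ.+ c ℕ.* b) (b ℕ.* d)
  frac-+ a (suc b) c (suc d) = toℚᵘ-injective (ℚᵘ.≃-trans (toℚᵘ-homo-+ (frac a (suc b)) (frac c (suc d)))
    (ℚᵘ.≃-trans (ℚᵘ.+-cong (frac≃mkℚᵘ a b) (frac≃mkℚᵘ c d)) (ℚᵘ.≃-sym (ℚᵘ.≃-trans (frac≃mkℚᵘ _ _) (ℚᵘ.*≡* eq)))))
    where
    eq : (ℤ.+ (a ℕ.* suc d ℕ.+ c ℕ.* suc b)) ℤ.* (ℤ.+ suc (d ℕ.+ b ℕ.* suc d))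
       ≡ ((ℤ.+ a) ℤ.* (ℤ.+ suc d) ℤ.+ (ℤ.+ c) ℤ.* (ℤ.+ suc b)) ℤ.* (ℤ.+ suc (d ℕ.+ b ℕ.* suc d))
    eq rewrite sym (ℤ.pos-* a (suc d)) | sym (ℤ.pos-* c (suc b)) | ℤ.pos-+ (a ℕ.* suc d) (c ℕ.* suc b) = refl

  frac≤frac+frac : ∀ x a x′ a′ y b .{{_ : ℕ.NonZero a}} .{{_ : ℕ.NonZero a′}} .{{_ : ℕ.NonZero b}} →
    x′ ℕ.* a ℕ.* b ℕ.≤ x ℕ.* a′ ℕ.* b ℕ.+ y ℕ.* a ℕ.* a′ → frac x′ a′ ≤ frac x a + frac y b
  frac≤frac+frac x a@(suc _) x′ a′@(suc _) y b@(suc _) cross = subst (frac x′ a′ ≤_) (sym (frac-+ x a y b))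
    (frac-mono-≤ x′ a′ (x ℕ.* b ℕ.+ y ℕ.* a) (a ℕ.* b) (begin
      x′ ℕ.* (a ℕ.* b)                      ≡⟨ ℕ.*-assoc x′ a b ⟨
      x′ ℕ.* a ℕ.* b                        ≤⟨ cross ⟩
      x ℕ.* a′ ℕ.* b ℕ.+ y ℕ.* a ℕ.* a′     ≡⟨ NS.solve 5 (λ x a′ b y a → x NS.:* a′ NS.:* b NS.:+ y NS.:* a NS.:* a′
                                                             NS.:= (x NS.:* b NS.:+ y NS.:* a) NS.:* a′) refl x a′ b y a ⟩
      (x ℕ.* b ℕ.+ y ℕ.* a) ℕ.* a′          ∎))
    where
    open ℕ.≤-Reasoning
    module NS = Data.Nat.Solver.+-*-Solver

  ∣-∣≤-both : ∀ {x y e} → x ≤ y + e → y ≤ x + e → ∣ x - y ∣ ≤ e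
  ∣-∣≤-both {x} {y} {e} x≤y+e y≤x+e with ∣p∣≡p∨∣p∣≡-p (x - y)
  ... | inj₁ ∣x-y∣≡x-y = subst (_≤ e) (sym ∣x-y∣≡x-y)
    (≤-trans (+-monoˡ-≤ (- y) x≤y+e) (≤-reflexive (solve 2 (λ y e → (y :+ e) :- y := e) refl y e)))
  ... | inj₂ ∣x-y∣≡y-x = subst (_≤ e) (sym ∣x-y∣≡y-x)
    (≤-trans (≤-reflexive (solve 2 (λ x y → :- (x :- y) := y :- x) refl x y))
      (≤-trans (+-monoˡ-≤ (- x) y≤x+e) (≤-reflexive (solve 2 (λ x e → (x :+ e) :- x := e) refl x e))))

  private
    positive-numerator : ∀ ε → 0ℚ < ε → ∃[ p ] ↥ ε ≡ ℤ.+ suc p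
    positive-numerator (mkℚ (ℤ.+ zero)  _ _) (*<* 0<0)  = contradiction 0<0 (ℤ.<-irrefl refl)
    positive-numerator (mkℚ (ℤ.+ suc p) _ _) _          = p , refl
    positive-numerator (mkℚ ℤ.-[1+ p ]  d _) (*<* 0<ε)  =
      contradiction 0<ε (ℤ.<-asym (subst (ℤ._< ℤ.+ 0 ℤ.* ℤ.+ suc d) (sym (ℤ.*-identityʳ ℤ.-[1+ p ])) (ℤ.-<+ {p} {0})))

  frac+frac→0 : ∀ c ε → 0ℚ < ε → ∃[ L ] (∀ k k′ .{{_ : ℕ.NonZero k}} .{{_ : ℕ.NonZero k′}} → L ℕ.≤ k → L ℕ.≤ k′ → frac c k + frac c k′ < ε)
  frac+frac→0 c ε@(mkℚ _ d _) 0<ε with positive-numerator ε 0<ε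
  ... | p , refl = L , λ k k′ L≤k L≤k′ →
    ≤-<-trans (+-mono-≤ (shrinks k L≤k) (shrinks k′ L≤k′)) (subst (_< ε) (sym (frac-+ c L c L)) 2c/L<ε)
    where
    -- q is the denominator of ε, and 2c/L < 1/q ≤ ε
    q = suc d
    L = suc (2 ℕ.* c ℕ.* q)
    shrinks : ∀ k .{{_ : ℕ.NonZero k}} → L ℕ.≤ k → frac c k ≤ frac c L
    shrinks k L≤k = frac-mono-≤ c k c L (ℕ.*-monoʳ-≤ c L≤k)
    cross : (c ℕ.* L ℕ.+ c ℕ.* L) ℕ.* q ℕ.< suc p ℕ.* (L ℕ.* L)
    cross = begin-strict
      (c ℕ.* L ℕ.+ c ℕ.* L) ℕ.* q      ≡⟨ NS.solve 3 (λ c L q → (c NS.:* L NS.:+ c NS.:* L) NS.:* q NS.:= NS.con 2 NS.:* c NS.:* q NS.:* L) refl c L q ⟩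
      2 ℕ.* c ℕ.* q ℕ.* L              <⟨ ℕ.*-monoˡ-< L {{_}} (ℕ.n<1+n (2 ℕ.* c ℕ.* q)) ⟩
      L ℕ.* L                          ≤⟨ ℕ.m≤m+n (L ℕ.* L) (p ℕ.* (L ℕ.* L)) ⟩
      suc p ℕ.* (L ℕ.* L)              ∎
      where
      open ℕ.≤-Reasoning
      module NS = Data.Nat.Solver.+-*-Solver
    2c/L<ε : frac (c ℕ.* L ℕ.+ c ℕ.* L) (L ℕ.* L) < ε
    2c/L<ε = toℚᵘ-cancel-< (ℚᵘ.<-respˡ-≃ (ℚᵘ.≃-sym (frac≃mkℚᵘ (c ℕ.* L ℕ.+ c ℕ.* L) (ℕ.pred (L ℕ.* L))))
      (ℚᵘ.*<* (subst₂ ℤ._<_ (ℤ.pos-* (c ℕ.* L ℕ.+ c ℕ.* L) q) (ℤ.pos-* (suc p) (L ℕ.* L)) (ℤ.+<+ cross))))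


module Norms where

  open import Data.Nat using (zero; suc)
  open import Data.Fin using (Fin; zero; suc)
  open import Data.Fin.Properties using (all?) renaming (_≟_ to _≟ᶠ_)
  open import Data.Bool using (Bool; true; false; if_then_else_; _∧_)
  open import Data.Product using (Σ-syntax; ∃-syntax; _×_; _,_; proj₁; proj₂)
  open import Data.Sum using (inj₂)
  open import Data.List using (List; []; _∷_; allFin; cartesianProduct; cartesianProductWith; mapMaybe; map)
  open import Data.List.Membership.Propositional using (_∈_)
  open import Data.List.Membership.Propositional.Properties using (∈-allFin)
  open import Data.List.Relation.Unary.Any as Any using (Any; here; there)
  import Data.List.Relation.Unary.Any.Properties as Any
  open import Data.Maybe using (Maybe; just; nothing)
  import Data.Maybe.Relation.Unary.Any as MaybeAny
  open import Data.Vec.Functional using () renaming ([] to []ᵛ; _∷_ to _∷ᵛ_)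
  open import Function using (_∘_)
  open import Function.Bundles using (_↔_; Inverse; mk↔ₛ′)
  open import Relation.Nullary using (yes; no; contradiction)
  open import Relation.Binary.PropositionalEquality
  open import Data.Rational
  open import Data.Rational.Properties
  open import Relation.Binary.Bundles using (DecTotalOrder)
  import Data.List.Extrema (DecTotalOrder.totalOrder ≤-decTotalOrder) as Extrema
  open import Defs hiding (sym)
  open Rational

  colSum₁ : ∀ {a b} → Matrix a b → Fin b → ℚ
  colSum₁ B j = Σℚ (λ i → ∣ B i j ∣)

  unit : ∀ {b} → Fin b → Fin b → ℚ
  unit j* j = if Relation.Nullary.does (j ≟ᶠ j*) then 1ℚ else 0ℚ
    where import Relation.Nullary

  private
    Σℚ-unit : ∀ {n} (j* : Fin n) (f : Fin n → ℚ) → Σℚ (λ j → f j * unit j* j) ≡ f j*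
    Σℚ-unit {suc n} zero f = trans (cong₂ _+_ (*-identityʳ (f zero)) (trans (Σℚ-cong (λ j → *-zeroʳ (f (suc j)))) (Σℚ-zero n)))
                                   (+-identityʳ (f zero))
      where
      Σℚ-zero : ∀ n → Σℚ {n} (λ _ → 0ℚ) ≡ 0ℚ
      Σℚ-zero zero    = refl
      Σℚ-zero (suc n) = trans (+-identityˡ _) (Σℚ-zero n)
    Σℚ-unit {suc n} (suc j*) f = trans (cong₂ _+_ (*-zeroʳ (f zero)) (Σℚ-unit j* (f ∘ suc))) (+-identityˡ _)

    ∣unit∣ : ∀ {b} (j* j : Fin b) → ∣ unit j* j ∣ ≡ 1ℚ * unit j* j
    ∣unit∣ j* j with j ≟ᶠ j*
    ... | yes _ = refl
    ... | no _  = refl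

    unit-image : ∀ {a b} (B : Matrix a b) j → vnorm₁ (B ·v unit j) ≡ colSum₁ B j
    unit-image B j = Σℚ-cong (λ i → cong ∣_∣ (Σℚ-unit j (B i)))

    ∥unit∥ : ∀ {b} (j : Fin b) → vnorm₁ (unit j) ≡ 1ℚ
    ∥unit∥ j = trans (Σℚ-cong (∣unit∣ j)) (Σℚ-unit j (λ _ → 1ℚ))

  -- Unit vectors attain the largest column sum, and ‖Bx‖₁ ≤ ∑ⱼ colSum₁ B j ∣xⱼ∣.
  max-colSum-isOpNorm₁ : ∀ {a b} (B : Matrix a b) j* → (∀ j → colSum₁ B j ≤ colSum₁ B j*) → IsOpNorm₁ B (colSum₁ B j*)
  max-colSum-isOpNorm₁ B j* max = bounded , least
    where
    bounded : ∀ x → vnorm₁ (B ·v x) ≤ colSum₁ B j* * vnorm₁ x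
    bounded x = begin
      Σℚ (λ i → ∣ Σℚ (λ j → B i j * x j) ∣)       ≤⟨ Σℚ-mono-≤ (λ i → ≤-trans (∣Σℚ∣≤Σℚ∣∣ (λ j → B i j * x j))
                                                           (≤-reflexive (Σℚ-cong (λ j → ∣p*q∣≡∣p∣*∣q∣ (B i j) (x j))))) ⟩
      Σℚ (λ i → Σℚ (λ j → ∣ B i j ∣ * ∣ x j ∣))   ≡⟨ Σℚ-comm (λ i j → ∣ B i j ∣ * ∣ x j ∣) ⟩
      Σℚ (λ j → Σℚ (λ i → ∣ B i j ∣ * ∣ x j ∣))   ≡⟨ Σℚ-cong (λ j → Σℚ-*ʳ ∣ x j ∣ (λ i → ∣ B i j ∣)) ⟩
      Σℚ (λ j → colSum₁ B j * ∣ x j ∣)            ≤⟨ Σℚ-mono-≤ (λ j → *-monoʳ-≤-nonNeg ∣ x j ∣ {{∣-∣-nonNeg (x j)}} (max j)) ⟩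
      Σℚ (λ j → colSum₁ B j* * ∣ x j ∣)           ≡⟨ Σℚ-*ˡ (colSum₁ B j*) (λ j → ∣ x j ∣) ⟩
      colSum₁ B j* * vnorm₁ x                     ∎
      where open ≤-Reasoning
    least : ∀ d′ → (∀ x → vnorm₁ (B ·v x) ≤ d′ * vnorm₁ x) → colSum₁ B j* ≤ d′
    least d′ bound = subst₂ _≤_ (unit-image B j*) (trans (cong (d′ *_) (∥unit∥ j*)) (*-identityʳ d′)) (bound (unit j*))

  colSum₁≤opNorm : ∀ {a b} (B : Matrix a b) {d} → IsOpNorm₁ B d → ∀ j → colSum₁ B j ≤ d
  colSum₁≤opNorm B {d} (bounded , _) j =
    subst₂ _≤_ (unit-image B j) (trans (cong (d *_) (∥unit∥ j)) (*-identityʳ d)) (bounded (unit j))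

  IsNorm-unique : ∀ κ {a b} {B : Matrix a b} {d e} → IsNorm κ B d → IsNorm κ B e → d ≡ e
  IsNorm-unique entrywise ∥B∥≡d ∥B∥≡e = trans (sym ∥B∥≡d) ∥B∥≡e
  IsNorm-unique operator (bounded₁ , least₁) (bounded₂ , least₂) = ≤-antisym (least₁ _ bounded₂) (least₂ _ bounded₁)
  IsNorm-unique cut ((S , T , ≡d) , ≤d) ((S′ , T′ , ≡e) , ≤e) =
    ≤-antisym (subst (_≤ _) ≡d (≤e S T)) (subst (_≤ _) ≡e (≤d S′ T′))

  IsNorm-cong : ∀ κ {a b} {B B′ : Matrix a b} {d} → (∀ i j → B i j ≡ B′ i j) → IsNorm κ B d → IsNorm κ B′ d
  IsNorm-cong entrywise B≡B′ ∥B∥≡d = trans (sym (Σℚ-cong (λ i → Σℚ-cong (λ j → cong ∣_∣ (B≡B′ i j))))) ∥B∥≡d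
  IsNorm-cong operator {B = B} {B′} B≡B′ (bounded , least) =
    (λ x → subst (_≤ _) (same x) (bounded x)) , (λ d′ bound → least d′ (λ x → subst (_≤ _) (sym (same x)) (bound x)))
    where
    same : ∀ x → vnorm₁ (B ·v x) ≡ vnorm₁ (B′ ·v x)
    same x = Σℚ-cong (λ i → cong ∣_∣ (Σℚ-cong (λ j → cong (_* x j) (B≡B′ i j))))
  IsNorm-cong cut {B = B} {B′} B≡B′ ((S , T , attained) , ≤d) =
    (S , T , trans (cong ∣_∣ (sym (same S T))) attained) , (λ S T → subst (_≤ _) (cong ∣_∣ (same S T)) (≤d S T))
    where
    same : ∀ S T → blockSum B S T ≡ blockSum B′ S T
    same S T = Σℚ-cong (λ i → Σℚ-cong (λ j → cong (if S i ∧ T j then_else 0ℚ) (B≡B′ i j)))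

  allFunctions : ∀ {A : Set} → List A → ∀ n → List (Fin n → A)
  allFunctions as zero    = []ᵛ ∷ []
  allFunctions as (suc n) = cartesianProductWith _∷ᵛ_ as (allFunctions as n)

  allFunctions-complete : ∀ {A : Set} {as : List A} → (∀ a → a ∈ as) →
    ∀ n (f : Fin n → A) → Any (λ g → ∀ i → g i ≡ f i) (allFunctions as n)
  allFunctions-complete all∈ zero    f = here (λ ())
  allFunctions-complete all∈ (suc n) f =
    Any.cartesianProductWith⁺ _∷ᵛ_ (λ { refl g≗f zero → refl ; refl g≗f (suc i) → g≗f i })
      (all∈ (f zero)) (allFunctions-complete all∈ n (f ∘ suc))

  private
    argmax-bound : ∀ {A : Set} (v : A → ℚ) (⊥ : A) xs {x} {P : A → Set} →
      Any P xs → (∀ {y} → P y → v x ≤ v y) → v x ≤ v (Extrema.argmax v ⊥ xs)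
    argmax-bound v ⊥ xs Py bound = Extrema.v≤f[argmax]⁺ ⊥ xs (inj₂ (Any.map bound Py))

    argmin-bound : ∀ {A : Set} (v : A → ℚ) (⊤ : A) xs {x} {P : A → Set} →
      Any P xs → (∀ {y} → P y → v y ≤ v x) → v (Extrema.argmin v ⊤ xs) ≤ v x
    argmin-bound v ⊤ xs Py bound = Extrema.f[argmin]≤v⁺ ⊤ xs (inj₂ (Any.map bound Py))

  bools : List Bool
  bools = true ∷ false ∷ []

  bools-complete : ∀ b → b ∈ bools
  bools-complete true  = here refl
  bools-complete false = there (here refl)

  cutNorm-exists : ∀ {a b} (B : Matrix a b) → ∃[ d ] IsCutNorm B d
  cutNorm-exists {a} {b} B = value best , (proj₁ best , proj₂ best , refl) , λ S T →
    argmax-bound value (default , default) pairs {S , T}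
      (Any.cartesianProductWith⁺ _,_ (λ S′≗S T′≗T → S′≗S , T′≗T)
         (allFunctions-complete bools-complete a S) (allFunctions-complete bools-complete b T))
      (λ (S′≗S , T′≗T) → ≤-reflexive (cong ∣_∣ (blockSum-cong S′≗S T′≗T)))
    where
    default : ∀ {n} → Fin n → Bool
    default _ = true
    pairs : List ((Fin a → Bool) × (Fin b → Bool))
    pairs = cartesianProduct (allFunctions bools a) (allFunctions bools b)
    value : (Fin a → Bool) × (Fin b → Bool) → ℚ
    value (S , T) = ∣ blockSum B S T ∣
    best : (Fin a → Bool) × (Fin b → Bool)
    best = Extrema.argmax value (default , default) pairs
    blockSum-cong : ∀ {S S′ T T′} → (∀ i → S′ i ≡ S i) → (∀ j → T′ j ≡ T j) → blockSum B S T ≡ blockSum B S′ T′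
    blockSum-cong S′≗S T′≗T = Σℚ-cong (λ i → Σℚ-cong (λ j → cong₂ (λ s t → if s ∧ t then B i j else 0ℚ) (sym (S′≗S i)) (sym (T′≗T j))))

  opNorm-attained : ∀ {a b} (B : Matrix a b) → Fin b → Σ[ j* ∈ Fin b ] IsOpNorm₁ B (colSum₁ B j*)
  opNorm-attained {b = b} B j₀ = j* , max-colSum-isOpNorm₁ B j* λ j →
    argmax-bound (colSum₁ B) j₀ (allFin b) (∈-allFin j) λ { refl → ≤-refl }
    where
    j* : Fin b
    j* = Extrema.argmax (colSum₁ B) j₀ (allFin b)

  norm-exists : ∀ κ {M} (B : Matrix M M) → Fin M → ∃[ d ] IsNorm κ B d
  norm-exists entrywise B _  = norm₍₁₎ B , refl
  norm-exists operator  B j₀ = let j* , isOp = opNorm-attained B j₀ in colSum₁ B j* , isOp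
  norm-exists cut       B _  = cutNorm-exists B

  private
    as-inverse : ∀ {N M} → (Fin N → Fin M) × (Fin M → Fin N) → Maybe (Fin N ↔ Fin M)
    as-inverse (f , g) with all? (λ y → f (g y) ≟ᶠ y) | all? (λ x → g (f x) ≟ᶠ x)
    ... | yes fg≗id | yes gf≗id = just (mk↔ₛ′ f g fg≗id gf≗id)
    ... | _         | _         = nothing

  bijections : ∀ N M → List (Fin N ↔ Fin M)
  bijections N M = mapMaybe as-inverse (cartesianProduct (allFunctions (allFin M) N) (allFunctions (allFin N) M))

  bijections-complete : ∀ {N M} (π : Fin N ↔ Fin M) →
    Any (λ π′ → ∀ y → Inverse.from π′ y ≡ Inverse.from π y) (bijections N M)
  bijections-complete {N} {M} π = Any.mapMaybe⁺ as-inverse _ (Any.map⁺ (Any.map found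
    (Any.cartesianProductWith⁺ _,_ _,_ (allFunctions-complete ∈-allFin N (Inverse.to π))
                                       (allFunctions-complete ∈-allFin M (Inverse.from π)))))
    where
    found : ∀ {fg} → (∀ x → proj₁ fg x ≡ Inverse.to π x) × (∀ y → proj₂ fg y ≡ Inverse.from π y) →
            MaybeAny.Any (λ π′ → ∀ y → Inverse.from π′ y ≡ Inverse.from π y) (as-inverse fg)
    found {f , g} (f≗to , g≗from) with all? (λ y → f (g y) ≟ᶠ y) | all? (λ x → g (f x) ≟ᶠ x)
    ... | yes _ | yes _ = MaybeAny.just g≗from
    ... | no ¬fg≗id | _ = contradiction (λ y → trans (trans (f≗to (g y)) (cong (Inverse.to π) (g≗from y))) (Inverse.strictlyInverseˡ π y)) ¬fg≗id
    ... | yes _ | no ¬gf≗id = contradiction (λ x → trans (trans (g≗from (f x)) (cong (Inverse.from π) (f≗to x))) (Inverse.strictlyInverseʳ π x)) ¬gf≗id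

  dist-exists : ∀ κ {N M} (A : Matrix N N) (B : Matrix M M) → (∀ X → ∃[ d ] IsNorm κ X d) → Fin N ↔ Fin M →
    ∃[ d ] (∃[ π ] IsNorm κ (permDiff A π B) d) × (∀ π e → IsNorm κ (permDiff A π B) e → d ≤ e)
  dist-exists κ {N} {M} A B norm π₀ = value best , (best , isNorm best) , λ π e isNorm-e →
    subst (value best ≤_) (IsNorm-unique κ (isNorm π) isNorm-e)
      (argmin-bound value π₀ (bijections N M) {π} (bijections-complete π) λ {π′} from≗ →
        ≤-reflexive (IsNorm-unique κ (IsNorm-cong κ (λ w w′ → cong₂ (λ x y → A x y - B w w′) (from≗ w) (from≗ w′)) (isNorm π′)) (isNorm π)))
    where
    value : Fin N ↔ Fin M → ℚ
    value π = proj₁ (norm (permDiff A π B))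
    isNorm : ∀ π → IsNorm κ (permDiff A π B) (value π)
    isNorm π = proj₂ (norm (permDiff A π B))
    best : Fin N ↔ Fin M
    best = Extrema.argmin value π₀ (bijections N M)


module Types where

  open import Data.Nat
  open import Data.Nat.Properties
  open import Data.Fin using (Fin; zero; suc)
  open import Data.Fin.Properties using (any?) renaming (_≟_ to _≟ᶠ_)
  open import Data.Bool using (Bool)
  open import Data.Product using (∃-syntax; _,_)
  open import Function using (_∘_)
  open import Relation.Nullary using (Dec; yes; no; does; contradiction)
  open import Relation.Binary.PropositionalEquality
  open FinSum

  module TypeCounts {M K : ℕ} (c : Fin M → Fin K) where

    countOf : (Fin M → ℕ) → Fin K → ℕ
    countOf a p = ∑[ w < M ] (a w * δ (c w) p)

    count : Fin K → ℕ
    count p = ∑[ w < M ] δ (c w) p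

    countOf-1 : ∀ p → countOf (λ _ → 1) p ≡ count p
    countOf-1 p = sum-cong-≗ (λ w → +-identityʳ (δ (c w) p))

    sum-by-type : ∀ (a : Fin M → ℕ) (g : Fin K → ℕ) → ∑[ w < M ] (a w * g (c w)) ≡ ∑[ p < K ] (countOf a p * g p)
    sum-by-type a g = begin
      ∑[ w < M ] (a w * g (c w))                        ≡⟨ sum-cong-≗ (λ w → cong (a w *_) (sum-δ (c w) g)) ⟨
      ∑[ w < M ] (a w * ∑[ p < K ] (δ (c w) p * g p))   ≡⟨ sum-cong-≗ (λ w → sum-*ˡ (a w) (λ p → δ (c w) p * g p)) ⟨
      ∑[ w < M ] ∑[ p < K ] (a w * (δ (c w) p * g p))   ≡⟨ ∑-comm (λ w p → a w * (δ (c w) p * g p)) ⟩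
      ∑[ p < K ] ∑[ w < M ] (a w * (δ (c w) p * g p))   ≡⟨ sum-cong-≗ (λ p → trans (sum-cong-≗ (λ w → sym (*-assoc (a w) _ (g p))))
                                                                                (sum-*ʳ (g p) (λ w → a w * δ (c w) p))) ⟩
      ∑[ p < K ] (countOf a p * g p)                    ∎
      where open ≡-Reasoning

    sum-by-type₂ : ∀ (a b : Fin M → ℕ) (g : Fin K → Fin K → ℕ) →
      ∑[ w < M ] ∑[ w′ < M ] (a w * b w′ * g (c w) (c w′)) ≡ ∑[ p < K ] ∑[ q < K ] (countOf a p * countOf b q * g p q)
    sum-by-type₂ a b g = begin
      ∑[ w < M ] ∑[ w′ < M ] (a w * b w′ * g (c w) (c w′))
        ≡⟨ sum-cong-≗ (λ w → trans (sum-cong-≗ (λ w′ → trans (*-assoc (a w) (b w′) _) (*-comm (a w) _)))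
                                  (trans (sum-*ʳ (a w) (λ w′ → b w′ * g (c w) (c w′)))
                                         (trans (cong (_* a w) (sum-by-type b (g (c w)))) (*-comm _ (a w))))) ⟩
      ∑[ w < M ] (a w * ∑[ q < K ] (countOf b q * g (c w) q))
        ≡⟨ sum-by-type a (λ p → ∑[ q < K ] (countOf b q * g p q)) ⟩
      ∑[ p < K ] (countOf a p * ∑[ q < K ] (countOf b q * g p q))
        ≡⟨ sum-cong-≗ (λ p → trans (sym (sum-*ˡ (countOf a p) (λ q → countOf b q * g p q)))
                                  (sum-cong-≗ (λ q → sym (*-assoc (countOf a p) (countOf b q) (g p q))))) ⟩
      ∑[ p < K ] ∑[ q < K ] (countOf a p * countOf b q * g p q) ∎
      where open ≡-Reasoning

    sum-countOf : ∀ (a : Fin M → ℕ) → sum (countOf a) ≡ sum a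
    sum-countOf a = begin
      ∑[ p < K ] ∑[ w < M ] (a w * δ (c w) p)   ≡⟨ ∑-comm (λ p w → a w * δ (c w) p) ⟩
      ∑[ w < M ] ∑[ p < K ] (a w * δ (c w) p)   ≡⟨ sum-cong-≗ (λ w → trans (sum-*ˡ (a w) (δ (c w)))
                                                               (trans (cong (a w *_) (sum-δ-count (c w))) (*-identityʳ (a w)))) ⟩
      sum a                                     ∎
      where open ≡-Reasoning

    countOf-𝟙≤count : ∀ (S : Fin M → Bool) p → countOf (𝟙 ∘ S) p ≤ count p
    countOf-𝟙≤count S p = sum-mono-≤ (λ w → ≤-trans (*-monoˡ-≤ (δ (c w) p) (𝟙≤1 (S w))) (≤-reflexive (*-identityˡ _)))

    count>0⇒∃ : ∀ p → 0 < count p → ∃[ w ] c w ≡ p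
    count>0⇒∃ p count>0 with any? (λ w → c w ≟ᶠ p)
    ... | yes found = found
    ... | no ¬found = contradiction (trans (sum-cong-≗ (λ w → δ-≢ (λ cw≡p → ¬found (w , cw≡p)))) (sum-replicate-zero M))
                                    (>⇒≢ count>0)

  open TypeCounts public

  select : ∀ {M K} → (Fin M → Fin K) → (Fin K → ℕ) → Fin M → Bool
  select c σ zero    = does (0 <? σ (c zero))
  select c σ (suc w) = select (c ∘ suc) (λ q → σ q ∸ δ (c zero) q) w

  countOf-select : ∀ {M K} (c : Fin M → Fin K) σ p → countOf c (𝟙 ∘ select c σ) p ≡ σ p ⊓ count c p
  countOf-select {zero}  c σ p = sym (⊓-zeroʳ (σ p))
  countOf-select {suc M} c σ p =
    trans (cong (𝟙 taken₀ * δ (c zero) p +_) (countOf-select (c ∘ suc) (λ q → σ q ∸ δ (c zero) q) p)) (first (c zero ≟ᶠ p))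
    where
    taken₀ = does (0 <? σ (c zero))
    rest = count (c ∘ suc) p
    first : Dec (c zero ≡ p) → 𝟙 taken₀ * δ (c zero) p + (σ p ∸ δ (c zero) p) ⊓ rest ≡ σ p ⊓ (δ (c zero) p + rest)
    first (yes refl) rewrite δ-refl (c zero) = taken (σ (c zero))
      where
      taken : ∀ s → 𝟙 (does (0 <? s)) * 1 + (s ∸ 1) ⊓ rest ≡ s ⊓ (1 + rest)
      taken zero    = refl
      taken (suc s) = refl
    first (no c₀≢p) rewrite δ-≢ c₀≢p | *-zeroʳ (𝟙 taken₀) = refl


module TypeMatrices where

  open import Data.Nat as ℕ using (ℕ)
  import Data.Nat.Properties as ℕ
  open import Data.Fin using (Fin)
  open import Data.Bool using (Bool; true; false; if_then_else_; _∧_)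
  open import Function using (_∘_)
  open import Relation.Binary.PropositionalEquality
  open import Data.Rational using (0ℚ; _-_; ∣_∣)
  open import Defs using (Matrix; norm₍₁₎; blockSum)
  open FinSum using (sum; sum-syntax; sum-cong-≗; 𝟙)
  open Rational
  open Norms using (colSum₁)
  open Types

  module TypeMatrix {M K : ℕ} (c : Fin M → Fin K) (g h : Fin K → Fin K → Bool) where

    matrix : Matrix M M
    matrix w w′ = fromℕ (𝟙 (g (c w) (c w′))) - fromℕ (𝟙 (h (c w) (c w′)))

    D : Fin K → Fin K → ℕ
    D p q = ℕ.∣ 𝟙 (g p q) - 𝟙 (h p q) ∣

    ∣matrix∣ : ∀ w w′ → ∣ matrix w w′ ∣ ≡ fromℕ (D (c w) (c w′))
    ∣matrix∣ w w′ = ∣fromℕ-fromℕ∣ (𝟙 (g (c w) (c w′))) (𝟙 (h (c w) (c w′)))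

    norm₍₁₎-matrix : norm₍₁₎ matrix ≡ fromℕ (∑[ p < K ] ∑[ q < K ] (count c p ℕ.* count c q ℕ.* D p q))
    norm₍₁₎-matrix = begin
      norm₍₁₎ matrix                                              ≡⟨ Σℚ-cong (λ w → trans (Σℚ-cong (∣matrix∣ w)) (Σℚ-fromℕ (λ w′ → D (c w) (c w′)))) ⟩
      Defs.Σℚ (λ w → fromℕ (∑[ w′ < M ] D (c w) (c w′)))          ≡⟨ Σℚ-fromℕ (λ w → ∑[ w′ < M ] D (c w) (c w′)) ⟩
      fromℕ (∑[ w < M ] ∑[ w′ < M ] D (c w) (c w′))                ≡⟨ cong fromℕ (sum-cong-≗ (λ w → sum-cong-≗ (λ w′ → sym (ℕ.*-identityˡ (D (c w) (c w′)))))) ⟩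
      fromℕ (∑[ w < M ] ∑[ w′ < M ] (1 ℕ.* 1 ℕ.* D (c w) (c w′)))  ≡⟨ cong fromℕ (sum-by-type₂ c (λ _ → 1) (λ _ → 1) D) ⟩
      fromℕ (∑[ p < K ] ∑[ q < K ] (countOf c (λ _ → 1) p ℕ.* countOf c (λ _ → 1) q ℕ.* D p q))
        ≡⟨ cong fromℕ (sum-cong-≗ (λ p → sum-cong-≗ (λ q → cong₂ (λ x y → x ℕ.* y ℕ.* D p q) (countOf-1 c p) (countOf-1 c q)))) ⟩
      fromℕ (∑[ p < K ] ∑[ q < K ] (count c p ℕ.* count c q ℕ.* D p q)) ∎
      where open ≡-Reasoning

    colSum₁-matrix : ∀ w′ → colSum₁ matrix w′ ≡ fromℕ (∑[ p < K ] (count c p ℕ.* D p (c w′)))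
    colSum₁-matrix w′ = begin
      colSum₁ matrix w′                                 ≡⟨ trans (Σℚ-cong (λ w → ∣matrix∣ w w′)) (Σℚ-fromℕ (λ w → D (c w) (c w′))) ⟩
      fromℕ (∑[ w < M ] D (c w) (c w′))                 ≡⟨ cong fromℕ (sum-cong-≗ (λ w → sym (ℕ.*-identityˡ (D (c w) (c w′))))) ⟩
      fromℕ (∑[ w < M ] (1 ℕ.* D (c w) (c w′)))         ≡⟨ cong fromℕ (sum-by-type c (λ _ → 1) (λ p → D p (c w′))) ⟩
      fromℕ (∑[ p < K ] (countOf c (λ _ → 1) p ℕ.* D p (c w′))) ≡⟨ cong fromℕ (sum-cong-≗ (λ p → cong (ℕ._* D p (c w′)) (countOf-1 c p))) ⟩
      fromℕ (∑[ p < K ] (count c p ℕ.* D p (c w′)))     ∎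
      where open ≡-Reasoning

    pairs : (Fin M → Bool) → (Fin M → Bool) → (Fin K → Fin K → Bool) → ℕ
    pairs S T f = ∑[ p < K ] ∑[ q < K ] (countOf c (𝟙 ∘ S) p ℕ.* countOf c (𝟙 ∘ T) q ℕ.* 𝟙 (f p q))

    ∣blockSum-matrix∣ : ∀ S T → ∣ blockSum matrix S T ∣ ≡ fromℕ ℕ.∣ pairs S T g - pairs S T h ∣
    ∣blockSum-matrix∣ S T = trans (cong ∣_∣ blockSum≡) (∣fromℕ-fromℕ∣ (pairs S T g) (pairs S T h))
      where
      term : (Fin K → Fin K → Bool) → Fin M → Fin M → ℕ
      term f w w′ = 𝟙 (S w) ℕ.* 𝟙 (T w′) ℕ.* 𝟙 (f (c w) (c w′))
      entry : ∀ s t x y → (if s ∧ t then fromℕ (𝟙 x) - fromℕ (𝟙 y) else 0ℚ) ≡ fromℕ (𝟙 s ℕ.* 𝟙 t ℕ.* 𝟙 x) - fromℕ (𝟙 s ℕ.* 𝟙 t ℕ.* 𝟙 y)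
      entry true  true  x y = cong₂ (λ a b → fromℕ a - fromℕ b) (sym (ℕ.+-identityʳ (𝟙 x))) (sym (ℕ.+-identityʳ (𝟙 y)))
      entry true  false x y = refl
      entry false t     x y = refl
      total : ∀ f → Defs.Σℚ (λ w → Defs.Σℚ (λ w′ → fromℕ (term f w w′))) ≡ fromℕ (pairs S T f)
      total f = trans (Σℚ-cong (λ w → Σℚ-fromℕ (term f w))) (trans (Σℚ-fromℕ (λ w → sum (term f w)))
                  (cong fromℕ (sum-by-type₂ c (𝟙 ∘ S) (𝟙 ∘ T) (λ p q → 𝟙 (f p q)))))
      blockSum≡ : blockSum matrix S T ≡ fromℕ (pairs S T g) - fromℕ (pairs S T h)
      blockSum≡ = begin
        blockSum matrix S T
          ≡⟨ Σℚ-cong (λ w → trans (Σℚ-cong (λ w′ → entry (S w) (T w′) (g (c w) (c w′)) (h (c w) (c w′))))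
                                 (Σℚ-sub (λ w′ → fromℕ (term g w w′)) (λ w′ → fromℕ (term h w w′)))) ⟩
        Defs.Σℚ (λ w → Defs.Σℚ (λ w′ → fromℕ (term g w w′)) - Defs.Σℚ (λ w′ → fromℕ (term h w w′)))
          ≡⟨ Σℚ-sub (λ w → Defs.Σℚ (λ w′ → fromℕ (term g w w′))) (λ w → Defs.Σℚ (λ w′ → fromℕ (term h w w′))) ⟩
        Defs.Σℚ (λ w → Defs.Σℚ (λ w′ → fromℕ (term g w w′))) - Defs.Σℚ (λ w → Defs.Σℚ (λ w′ → fromℕ (term h w w′)))
          ≡⟨ cong₂ _-_ (total g) (total h) ⟩
        fromℕ (pairs S T g) - fromℕ (pairs S T h) ∎
        where open ≡-Reasoning


module Coupling where

  open import Data.Nat using (ℕ; zero; suc; _+_; _*_)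
  import Data.Nat.Properties as ℕ
  open import Data.Fin using (Fin; zero; suc; _↑ˡ_; _↑ʳ_; combine; remQuot; splitAt; cast; join)
  open import Data.Fin.Properties using (remQuot-combine; combine-remQuot; combine-injective; splitAt-↑ˡ; splitAt-↑ʳ;
                                         join-splitAt; cast-involutive) renaming (_≟_ to _≟ᶠ_)
  open import Data.Product using (Σ-syntax; _×_; _,_; proj₁; proj₂; uncurry)
  open import Data.Sum using (_⊎_; inj₁; inj₂)
  open import Function using (_∘_)
  open import Function.Bundles using (_↔_; Inverse; mk↔ₛ′)
  import Function.Construct.Symmetry as Symmetry
  open import Relation.Nullary using (yes; no)
  open import Relation.Binary.PropositionalEquality
  open FinSum
  open Types using (count)
  open import Algebra.Properties.Semiring.Sum ℕ.+-*-semiring using (sum-permute)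
  import Data.Nat.Solver

  mutual
    split : ∀ {n} (a : Fin n → ℕ) → Fin (sum a) → Σ[ j ∈ Fin n ] Fin (a j)
    split {suc n} a x = split-⊎ a (splitAt (a zero) x)

    private
      split-⊎ : ∀ {n} (a : Fin (suc n) → ℕ) → Fin (a zero) ⊎ Fin (sum (a ∘ suc)) → Σ[ j ∈ Fin (suc n) ] Fin (a j)
      split-⊎ a (inj₁ t) = zero , t
      split-⊎ a (inj₂ y) = suc (proj₁ (split (a ∘ suc) y)) , proj₂ (split (a ∘ suc) y)

  glue : ∀ {n} (a : Fin n → ℕ) → Σ[ j ∈ Fin n ] Fin (a j) → Fin (sum a)
  glue {suc n} a (zero  , t) = t ↑ˡ sum (a ∘ suc)
  glue {suc n} a (suc j , t) = a zero ↑ʳ glue (a ∘ suc) (j , t)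

  split-glue : ∀ {n} (a : Fin n → ℕ) x → split a (glue a x) ≡ x
  split-glue {suc n} a (zero  , t) rewrite splitAt-↑ˡ (a zero) t (sum (a ∘ suc)) = refl
  split-glue {suc n} a (suc j , t) rewrite splitAt-↑ʳ (a zero) (sum (a ∘ suc)) (glue (a ∘ suc) (j , t))
                                          | split-glue (a ∘ suc) (j , t) = refl

  glue-split : ∀ {n} (a : Fin n → ℕ) x → glue a (split a x) ≡ x
  glue-split {suc n} a x = trans (glue-split-⊎ (splitAt (a zero) x)) (join-splitAt (a zero) (sum (a ∘ suc)) x)
    where
    glue-split-⊎ : ∀ y → glue a (split-⊎ a y) ≡ join (a zero) (sum (a ∘ suc)) y
    glue-split-⊎ (inj₁ t) = refl
    glue-split-⊎ (inj₂ y) = cong (a zero ↑ʳ_) (glue-split (a ∘ suc) y)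

  sum-glue : ∀ {n} (a : Fin n → ℕ) (f : Fin (sum a) → ℕ) → sum f ≡ ∑[ j < n ] ∑[ t < a j ] f (glue a (j , t))
  sum-glue {zero}  a f = refl
  sum-glue {suc n} a f = trans (sum-↑ (a zero) (sum (a ∘ suc)) f)
                               (cong (∑[ t < a zero ] f (t ↑ˡ sum (a ∘ suc)) +_) (sum-glue (a ∘ suc) (f ∘ (a zero ↑ʳ_))))

  δ-combine : ∀ {m n} (a i : Fin m) (b j : Fin n) → δ (combine a b) (combine i j) ≡ δ a i * δ b j
  δ-combine a i b j with a ≟ᶠ i | b ≟ᶠ j
  ... | yes refl | yes refl = δ-refl (combine a b)
  ... | no a≢i   | _        = δ-≢ (a≢i ∘ proj₁ ∘ combine-injective a b i j)
  ... | yes _    | no b≢j   = δ-≢ (b≢j ∘ proj₂ ∘ combine-injective a b i j)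

  block : ∀ {m} r → Fin (m * r) → Fin m
  block r v = proj₁ (remQuot r v)

  block-size : ∀ m r (i : Fin m) → ∑[ v < m * r ] δ (block {m} r v) i ≡ r
  block-size m r i = begin
    ∑[ v < m * r ] δ (block {m} r v) i                        ≡⟨ sum-combine m r (λ v → δ (block {m} r v) i) ⟩
    ∑[ a < m ] ∑[ t < r ] δ (block {m} r (combine a t)) i
      ≡⟨ sum-cong-≗ (λ a → sum-cong-≗ (λ t → cong (λ x → δ (proj₁ x) i) (remQuot-combine {k = r} a t))) ⟩
    ∑[ a < m ] ∑[ t < r ] δ a i                           ≡⟨ sum-cong-≗ (λ a → trans (sum-const r (δ a i)) (ℕ.*-comm r (δ a i))) ⟩
    ∑[ a < m ] (δ a i * r)                                ≡⟨ sum-cong-≗ (λ a → cong (_* r) (δ-sym a i)) ⟩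
    ∑[ a < m ] (δ i a * r)                                ≡⟨ sum-δ i (λ _ → r) ⟩
    r                                                     ∎
    where open ≡-Reasoning

  sum-∘from : ∀ {N M} (π : Fin N ↔ Fin M) (f : Fin N → ℕ) → ∑[ w < M ] f (Inverse.from π w) ≡ sum f
  sum-∘from π f = sym (sum-permute f (Symmetry.↔-sym π))

  module _ {m n r s : ℕ} where

    cellOf : Fin (m * r) ↔ Fin (n * s) → Fin (n * s) → Fin (m * n)
    cellOf π w = combine (block {m} r (Inverse.from π w)) (block {n} s w)

    coupling : Fin (m * r) ↔ Fin (n * s) → Fin m → Fin n → ℕ
    coupling π i j = count (cellOf π) (combine i j)

    private
      coupling-split : ∀ π i j → coupling π i j ≡ ∑[ w < n * s ] (δ (block {m} r (Inverse.from π w)) i * δ (block {n} s w) j)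
      coupling-split π i j = sum-cong-≗ (λ w → δ-combine (block {m} r (Inverse.from π w)) i (block {n} s w) j)

    coupling-rows : ∀ π i → ∑[ j < n ] coupling π i j ≡ r
    coupling-rows π i = begin
      ∑[ j < n ] coupling π i j                                                    ≡⟨ sum-cong-≗ (coupling-split π i) ⟩
      ∑[ j < n ] ∑[ w < n * s ] (δ (block {m} r (Inverse.from π w)) i * δ (block {n} s w) j)
        ≡⟨ ∑-comm (λ j w → δ (block {m} r (Inverse.from π w)) i * δ (block {n} s w) j) ⟩
      ∑[ w < n * s ] ∑[ j < n ] (δ (block {m} r (Inverse.from π w)) i * δ (block {n} s w) j)
        ≡⟨ sum-cong-≗ (λ w → trans (sum-*ˡ (δ (block {m} r (Inverse.from π w)) i) (δ (block {n} s w)))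
                                   (trans (cong (δ (block {m} r (Inverse.from π w)) i *_) (sum-δ-count (block {n} s w)))
                                          (ℕ.*-identityʳ _))) ⟩
      ∑[ w < n * s ] δ (block {m} r (Inverse.from π w)) i                              ≡⟨ sum-∘from π (λ v → δ (block {m} r v) i) ⟩
      ∑[ v < m * r ] δ (block {m} r v) i                                               ≡⟨ block-size m r i ⟩
      r                                                                            ∎
      where open ≡-Reasoning

    coupling-cols : ∀ π j → ∑[ i < m ] coupling π i j ≡ s
    coupling-cols π j = begin
      ∑[ i < m ] coupling π i j                                                    ≡⟨ sum-cong-≗ (λ i → coupling-split π i j) ⟩
      ∑[ i < m ] ∑[ w < n * s ] (δ (block {m} r (Inverse.from π w)) i * δ (block {n} s w) j)
        ≡⟨ ∑-comm (λ i w → δ (block {m} r (Inverse.from π w)) i * δ (block {n} s w) j) ⟩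
      ∑[ w < n * s ] ∑[ i < m ] (δ (block {m} r (Inverse.from π w)) i * δ (block {n} s w) j)
        ≡⟨ sum-cong-≗ (λ w → trans (sum-*ʳ (δ (block {n} s w) j) (δ (block {m} r (Inverse.from π w))))
                                   (trans (cong (_* δ (block {n} s w) j) (sum-δ-count (block {m} r (Inverse.from π w))))
                                          (ℕ.*-identityˡ _))) ⟩
      ∑[ w < n * s ] δ (block {n} s w) j                                               ≡⟨ block-size n s j ⟩
      s                                                                            ∎
      where open ≡-Reasoning

    -- Match the cells (i, j, u), u < Y i j, in row-major order on the left and in
    -- column-major order on the right.
    realise : (Y : Fin m → Fin n → ℕ) → (∀ i → ∑[ j < n ] Y i j ≡ r) → (∀ j → ∑[ i < m ] Y i j ≡ s) →
              Σ[ π ∈ Fin (m * r) ↔ Fin (n * s) ] (∀ i j → coupling π i j ≡ Y i j)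
    realise Y rows cols = π , couples
      where
      Cell : Set
      Cell = Σ[ i ∈ Fin m ] Σ[ j ∈ Fin n ] Fin (Y i j)

      column : Fin n → Fin m → ℕ
      column j i = Y i j

      cellᴳ : Fin m × Fin r → Cell
      cellᴳ (i , t) = i , split (Y i) (cast (sym (rows i)) t)

      cellᴴ : Fin n × Fin s → Cell
      cellᴴ (j , t) = let i , u = split (column j) (cast (sym (cols j)) t) in i , j , u

      fromᴳ : Fin (m * r) → Cell
      fromᴳ = cellᴳ ∘ remQuot r

      fromᴴ : Fin (n * s) → Cell
      fromᴴ = cellᴴ ∘ remQuot s

      toᴳ : Cell → Fin (m * r)
      toᴳ (i , j , u) = combine i (cast (rows i) (glue (Y i) (j , u)))

      toᴴ : Cell → Fin (n * s)
      toᴴ (i , j , u) = combine j (cast (cols j) (glue (column j) (i , u)))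

      fromᴳ-toᴳ : ∀ x → fromᴳ (toᴳ x) ≡ x
      fromᴳ-toᴳ (i , j , u) = trans (cong cellᴳ (remQuot-combine i _))
        (cong (i ,_) (trans (cong (split (Y i)) (cast-involutive (sym (rows i)) (rows i) _)) (split-glue (Y i) (j , u))))

      toᴳ-fromᴳ : ∀ v → toᴳ (fromᴳ v) ≡ v
      toᴳ-fromᴳ v = trans (toᴳ-cellᴳ (remQuot r v)) (combine-remQuot {m} r v)
        where
        toᴳ-cellᴳ : ∀ p → toᴳ (cellᴳ p) ≡ uncurry combine p
        toᴳ-cellᴳ (i , t) = cong (combine i) (trans (cong (cast (rows i)) (glue-split (Y i) _))
                                                    (cast-involutive (rows i) (sym (rows i)) t))

      fromᴴ-toᴴ : ∀ x → fromᴴ (toᴴ x) ≡ x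
      fromᴴ-toᴴ (i , j , u) = trans (cong cellᴴ (remQuot-combine j _))
        (cong (λ x → proj₁ x , j , proj₂ x)
              (trans (cong (split (column j)) (cast-involutive (sym (cols j)) (cols j) _)) (split-glue (column j) (i , u))))

      toᴴ-fromᴴ : ∀ w → toᴴ (fromᴴ w) ≡ w
      toᴴ-fromᴴ w = trans (toᴴ-cellᴴ (remQuot s w)) (combine-remQuot {n} s w)
        where
        toᴴ-cellᴴ : ∀ p → toᴴ (cellᴴ p) ≡ uncurry combine p
        toᴴ-cellᴴ (j , t) = cong (combine j) (trans (cong (cast (cols j)) (glue-split (column j) _))
                                                    (cast-involutive (cols j) (sym (cols j)) t))

      π : Fin (m * r) ↔ Fin (n * s)
      π = mk↔ₛ′ (toᴴ ∘ fromᴳ) (toᴳ ∘ fromᴴ)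
                (λ w → trans (cong toᴴ (fromᴳ-toᴳ (fromᴴ w))) (toᴴ-fromᴴ w))
                (λ v → trans (cong toᴳ (fromᴴ-toᴴ (fromᴳ v))) (toᴳ-fromᴳ v))

      cellIndex : Cell → Fin (m * n)
      cellIndex (i , j , _) = combine i j

      cellOf≡ : ∀ w → cellOf π w ≡ cellIndex (fromᴴ w)
      cellOf≡ w = cong₂ combine (cong proj₁ (remQuot-combine (proj₁ (fromᴴ w)) _)) refl

      couples : ∀ i₀ j₀ → coupling π i₀ j₀ ≡ Y i₀ j₀
      couples i₀ j₀ = begin
        coupling π i₀ j₀
          ≡⟨ sum-cong-≗ (λ w → cong (λ x → δ x (combine i₀ j₀)) (cellOf≡ w)) ⟩
        ∑[ w < n * s ] F (fromᴴ w)
          ≡⟨ sum-combine n s (F ∘ fromᴴ) ⟩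
        ∑[ j < n ] ∑[ t < s ] F (fromᴴ (combine j t))
          ≡⟨ sum-cong-≗ (λ j → sum-cong-≗ (λ t → cong (F ∘ cellᴴ) (remQuot-combine j t))) ⟩
        ∑[ j < n ] ∑[ t < s ] F (cellᴴ (j , t))
          ≡⟨ sum-cong-≗ (λ j → sum-cast (sym (cols j)) (λ x → F (cellᴴ′ j x))) ⟩
        ∑[ j < n ] ∑[ x < sum (column j) ] F (cellᴴ′ j x)
          ≡⟨ sum-cong-≗ (λ j → sum-glue (column j) (F ∘ cellᴴ′ j)) ⟩
        ∑[ j < n ] ∑[ i < m ] ∑[ u < Y i j ] F (cellᴴ′ j (glue (column j) (i , u)))
          ≡⟨ sum-cong-≗ (λ j → sum-cong-≗ (λ i → sum-cong-≗ (λ u →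
               trans (cong (λ x → F (proj₁ x , j , proj₂ x)) (split-glue (column j) (i , u))) (δ-combine i i₀ j j₀)))) ⟩
        ∑[ j < n ] ∑[ i < m ] ∑[ u < Y i j ] (δ i i₀ * δ j j₀)
          ≡⟨ sum-cong-≗ (λ j → sum-cong-≗ (λ i → sum-const (Y i j) (δ i i₀ * δ j j₀))) ⟩
        ∑[ j < n ] ∑[ i < m ] (Y i j * (δ i i₀ * δ j j₀))
          ≡⟨ sum-cong-≗ (λ j → sum-cong-≗ (λ i → reorder i j)) ⟩
        ∑[ j < n ] ∑[ i < m ] (δ j j₀ * (δ i₀ i * Y i j))
          ≡⟨ sum-cong-≗ (λ j → sum-*ˡ (δ j j₀) (λ i → δ i₀ i * Y i j)) ⟩
        ∑[ j < n ] (δ j j₀ * ∑[ i < m ] (δ i₀ i * Y i j))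
          ≡⟨ sum-cong-≗ (λ j → trans (cong (_* ∑[ i < m ] (δ i₀ i * Y i j)) (δ-sym j j₀)) (cong (δ j₀ j *_) (sum-δ i₀ (column j)))) ⟩
        ∑[ j < n ] (δ j₀ j * Y i₀ j)
          ≡⟨ sum-δ j₀ (Y i₀) ⟩
        Y i₀ j₀ ∎
        where
        open ≡-Reasoning
        F : Cell → ℕ
        F x = δ (cellIndex x) (combine i₀ j₀)
        cellᴴ′ : ∀ j → Fin (sum (column j)) → Cell
        cellᴴ′ j x = let i , u = split (column j) x in i , j , u
        reorder : ∀ i j → Y i j * (δ i i₀ * δ j j₀) ≡ δ j j₀ * (δ i₀ i * Y i j)
        reorder i j = trans (cong (λ d → Y i j * (d * δ j j₀)) (δ-sym i i₀))
                            (solve 3 (λ y a b → y :* (a :* b) := b :* (a :* y)) refl (Y i j) (δ i₀ i) (δ j j₀))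
          where open Data.Nat.Solver.+-*-Solver


module Estimates where

  open import Data.Nat
  open import Data.Nat.Properties
  open import Data.Nat.DivMod using (_/_; _%_; m≡m%n+[m/n]*n; m%n<n; m/n*n≤m)
  open import Data.Fin using (Fin)
  open import Data.Bool using (Bool)
  open import Data.Sum using (inj₁; inj₂)
  open import Function using (_∘_)
  open import Relation.Binary.PropositionalEquality
  open import Data.Nat.Solver using (module +-*-Solver)
  open +-*-Solver using (solve; _:*_; _:+_; _:=_; con)
  open FinSum
  open Types
  open Rounding using (Rescaled)

  ∣-∣≤-both : ∀ a b e → a ≤ b + e → b ≤ a + e → ∣ a - b ∣ ≤ e
  ∣-∣≤-both a b e a≤b+e b≤a+e with ≤-total a b
  ... | inj₁ a≤b = subst (_≤ e) (sym (m≤n⇒∣m-n∣≡n∸m a≤b)) (subst (b ∸ a ≤_) (m+n∸m≡n a e) (∸-monoˡ-≤ a b≤a+e))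
  ... | inj₂ b≤a = subst (_≤ e) (trans (sym (m≤n⇒∣m-n∣≡n∸m b≤a)) (∣-∣-comm b a)) (subst (a ∸ b ≤_) (m+n∸m≡n b e) (∸-monoˡ-≤ b a≤b+e))

  ∣xy-uv∣≤ : ∀ x y u v → ∣ x * y - u * v ∣ ≤ ∣ x - u ∣ * y + u * ∣ y - v ∣
  ∣xy-uv∣≤ x y u v = ≤-trans (∣-∣-triangle (x * y) (u * y) (u * v))
    (≤-reflexive (cong₂ _+_ (sym (*-distribʳ-∣-∣ y x u)) (sym (*-distribˡ-∣-∣ u y v))))

  ∣ag-bg∣≤∣a-b∣ : ∀ a b g → g ≤ 1 → ∣ a * g - b * g ∣ ≤ ∣ a - b ∣
  ∣ag-bg∣≤∣a-b∣ a b g g≤1 = ≤-trans (≤-reflexive (sym (*-distribʳ-∣-∣ g a b)))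
                                    (≤-trans (*-monoʳ-≤ ∣ a - b ∣ g≤1) (≤-reflexive (*-identityʳ _)))

  sum-pairs : ∀ {K} (f : Fin K → ℕ) → ∑[ p < K ] ∑[ q < K ] (f p + f q) ≡ 2 * (K * sum f)
  sum-pairs {K} f = begin
    ∑[ p < K ] ∑[ q < K ] (f p + f q)                ≡⟨ sum-cong-≗ (λ p → ∑-distrib-+ (λ _ → f p) f) ⟩
    ∑[ p < K ] (∑[ q < K ] f p + sum f)              ≡⟨ ∑-distrib-+ (λ p → ∑[ q < K ] f p) (λ _ → sum f) ⟩
    ∑[ p < K ] ∑[ q < K ] f p + ∑[ p < K ] sum f     ≡⟨ cong₂ _+_ (trans (sum-cong-≗ (λ p → sum-const K (f p))) (sum-*ˡ K f)) (sum-const K (sum f)) ⟩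
    K * sum f + K * sum f                            ≡⟨ solve 1 (λ x → x :+ x := con 2 :* x) refl (K * sum f) ⟩
    2 * (K * sum f)                                  ∎
    where open ≡-Reasoning

  linear : ∀ {K} → (Fin K → ℕ) → (Fin K → Fin K → ℕ) → Fin K → ℕ
  linear {K} Z D q = ∑[ p < K ] (Z p * D p q)

  bilinear : ∀ {K} → (Fin K → ℕ) → (Fin K → ℕ) → (Fin K → Fin K → ℕ) → ℕ
  bilinear {K} a b F = ∑[ p < K ] ∑[ q < K ] (a p * b q * F p q)

  quadratic : ∀ {K} → (Fin K → ℕ) → (Fin K → Fin K → ℕ) → ℕ
  quadratic Z = bilinear Z Z

  module Comparison {K M M′ : ℕ} (k k′ : ℕ) .{{_ : NonZero k}} .{{_ : NonZero k′}}
    (c : Fin M → Fin K) (c′ : Fin M′ → Fin K)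
    (rescaled : ∀ p → Rescaled k k′ (count c p) (count c′ p))
    (M≡kK : M ≡ k * K) (M′≡k′K : M′ ≡ k′ * K) where

    open Rescaled

    Y Y′ : Fin K → ℕ
    Y  = count c
    Y′ = count c′

    ΣY≡kK : sum Y ≡ k * K
    ΣY≡kK = trans (trans (sum-cong-≗ (λ p → sym (countOf-1 c p))) (sum-countOf c (λ _ → 1)))
                  (trans (sum-const M 1) (trans (*-identityʳ M) M≡kK))

    quadratic-bound : ∀ D → (∀ p q → D p q ≤ 1) →
      quadratic Y′ D * (k * k) ≤ quadratic Y D * (k′ * k′) + 4 * (k + k′) * (k * k′) * (K * K)
    quadratic-bound D D≤1 = begin
      quadratic Y′ D * (k * k)
        ≡⟨ sum₂-*ʳ (k * k) (λ p q → Y′ p * Y′ q * D p q) ⟨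
      ∑[ p < K ] ∑[ q < K ] (Y′ p * Y′ q * D p q * (k * k))
        ≤⟨ sum-mono-≤ (λ p → sum-mono-≤ (λ q → entry p q)) ⟩
      ∑[ p < K ] ∑[ q < K ] (Y p * Y q * D p q * (k′ * k′) + ((Y p + Y q) * (k * k′) + k * k))
        ≡⟨ sum₂-distrib-+ (λ p q → Y p * Y q * D p q * (k′ * k′)) (λ p q → (Y p + Y q) * (k * k′) + k * k) ⟩
      ∑[ p < K ] ∑[ q < K ] (Y p * Y q * D p q * (k′ * k′)) + ∑[ p < K ] ∑[ q < K ] ((Y p + Y q) * (k * k′) + k * k)
        ≡⟨ cong₂ _+_ (sum₂-*ʳ (k′ * k′) (λ p q → Y p * Y q * D p q)) error-sum ⟩
      quadratic Y D * (k′ * k′) + (2 * (K * (k * K)) * (k * k′) + K * K * (k * k))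
        ≤⟨ +-monoʳ-≤ (quadratic Y D * (k′ * k′)) error-bound ⟩
      quadratic Y D * (k′ * k′) + 4 * (k + k′) * (k * k′) * (K * K) ∎
      where
      open ≤-Reasoning
      entry : ∀ p q → Y′ p * Y′ q * D p q * (k * k) ≤ Y p * Y q * D p q * (k′ * k′) + ((Y p + Y q) * (k * k′) + k * k)
      entry p q = let a = Y p ; b = Y q ; a′ = Y′ p ; b′ = Y′ q ; d = D p q in begin
        a′ * b′ * d * (k * k)                ≡⟨ solve 4 (λ a′ b′ d k → a′ :* b′ :* d :* (k :* k) := d :* ((a′ :* k) :* (b′ :* k))) refl a′ b′ d k ⟩
        d * ((a′ * k) * (b′ * k))            ≤⟨ *-monoʳ-≤ d (*-mono-≤ (upper (rescaled p)) (upper (rescaled q))) ⟩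
        d * ((a * k′ + k) * (b * k′ + k))    ≡⟨ solve 5 (λ a b k k′ d → d :* ((a :* k′ :+ k) :* (b :* k′ :+ k))
                                                      := a :* b :* d :* (k′ :* k′) :+ d :* ((a :+ b) :* (k :* k′) :+ k :* k)) refl a b k k′ d ⟩
        a * b * d * (k′ * k′) + d * ((a + b) * (k * k′) + k * k)
                                             ≤⟨ +-monoʳ-≤ (a * b * d * (k′ * k′)) (≤-trans (*-monoˡ-≤ _ (D≤1 p q)) (≤-reflexive (*-identityˡ _))) ⟩
        a * b * d * (k′ * k′) + ((a + b) * (k * k′) + k * k) ∎
      error-sum : ∑[ p < K ] ∑[ q < K ] ((Y p + Y q) * (k * k′) + k * k) ≡ 2 * (K * (k * K)) * (k * k′) + K * K * (k * k)
      error-sum = begin-equality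
        ∑[ p < K ] ∑[ q < K ] ((Y p + Y q) * (k * k′) + k * k)
          ≡⟨ sum₂-distrib-+ (λ p q → (Y p + Y q) * (k * k′)) (λ _ _ → k * k) ⟩
        ∑[ p < K ] ∑[ q < K ] ((Y p + Y q) * (k * k′)) + ∑[ p < K ] ∑[ q < K ] (k * k)
          ≡⟨ cong₂ _+_ (sum₂-*ʳ (k * k′) (λ p q → Y p + Y q))
                       (trans (sum-cong-≗ {K} {λ _ → ∑[ q < K ] (k * k)} (λ p → sum-const K (k * k))) (sum-const K (K * (k * k)))) ⟩
        ∑[ p < K ] ∑[ q < K ] (Y p + Y q) * (k * k′) + K * (K * (k * k))
          ≡⟨ cong₂ _+_ (cong (_* (k * k′)) (trans (sum-pairs Y) (cong (λ x → 2 * (K * x)) ΣY≡kK))) (sym (*-assoc K K (k * k))) ⟩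
        2 * (K * (k * K)) * (k * k′) + K * K * (k * k) ∎
      error-bound : 2 * (K * (k * K)) * (k * k′) + K * K * (k * k) ≤ 4 * (k + k′) * (k * k′) * (K * K)
      error-bound = begin
        2 * (K * (k * K)) * (k * k′) + K * K * (k * k)
          ≤⟨ +-monoʳ-≤ (2 * (K * (k * K)) * (k * k′)) (≤-trans (≤-reflexive (sym (*-identityʳ _))) (*-monoʳ-≤ (K * K * (k * k)) (>-nonZero⁻¹ k′))) ⟩
        2 * (K * (k * K)) * (k * k′) + K * K * (k * k) * k′
          ≤⟨ m≤m+n _ (k * k * k′ * (K * K) + 4 * k * (k′ * k′) * (K * K)) ⟩
        2 * (K * (k * K)) * (k * k′) + K * K * (k * k) * k′ + (k * k * k′ * (K * K) + 4 * k * (k′ * k′) * (K * K))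
          ≡⟨ solve 3 (λ K k k′ → con 2 :* (K :* (k :* K)) :* (k :* k′) :+ K :* K :* (k :* k) :* k′
                                 :+ (k :* k :* k′ :* (K :* K) :+ con 4 :* k :* (k′ :* k′) :* (K :* K))
                                 := con 4 :* (k :+ k′) :* (k :* k′) :* (K :* K)) refl K k k′ ⟩
        4 * (k + k′) * (k * k′) * (K * K) ∎

    linear-bound : ∀ D → (∀ p q → D p q ≤ 1) → ∀ q → linear Y′ D q * k ≤ linear Y D q * k′ + k * K
    linear-bound D D≤1 q = begin
      linear Y′ D q * k                        ≡⟨ sum-*ʳ k (λ p → Y′ p * D p q) ⟨
      ∑[ p < K ] (Y′ p * D p q * k)            ≤⟨ sum-mono-≤ entry ⟩
      ∑[ p < K ] (Y p * D p q * k′ + k)        ≡⟨ trans (∑-distrib-+ (λ p → Y p * D p q * k′) (λ _ → k))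
                                                       (cong₂ _+_ (sum-*ʳ k′ (λ p → Y p * D p q)) (trans (sum-const K k) (*-comm K k))) ⟩
      linear Y D q * k′ + k * K                ∎
      where
      open ≤-Reasoning
      entry : ∀ p → Y′ p * D p q * k ≤ Y p * D p q * k′ + k
      entry p = let d = D p q in begin
        Y′ p * d * k          ≡⟨ solve 3 (λ a d k → a :* d :* k := d :* (a :* k)) refl (Y′ p) d k ⟩
        d * (Y′ p * k)        ≤⟨ *-monoʳ-≤ d (upper (rescaled p)) ⟩
        d * (Y p * k′ + k)    ≡⟨ solve 4 (λ a d k k′ → d :* (a :* k′ :+ k) := a :* d :* k′ :+ d :* k) refl (Y p) d k k′ ⟩
        Y p * d * k′ + d * k  ≤⟨ +-monoʳ-≤ (Y p * d * k′) (≤-trans (*-monoˡ-≤ k (D≤1 p q)) (≤-reflexive (+-identityʳ k))) ⟩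
        Y p * d * k′ + k      ∎

    -- Of each type, take a k/k′ fraction of the vertices that X has of that type.
    imitate : (Fin M′ → Bool) → Fin M → Bool
    imitate X = select c (λ p → (countOf c′ (𝟙 ∘ X) p * k) / k′)

    module _ (X : Fin M′ → Bool) where
      private
        x′ x : Fin K → ℕ
        x′ = countOf c′ (𝟙 ∘ X)
        x  = countOf c (𝟙 ∘ imitate X)

      imitate-close : ∀ p → ∣ x′ p * k - x p * k′ ∣ ≤ k + k′
      imitate-close p = subst (λ z → ∣ x′ p * k - z * k′ ∣ ≤ k + k′) (sym (countOf-select c _ p))
                              (∣-∣≤-both _ _ _ above below)
        where
        quota : ℕ
        quota = (x′ p * k) / k′
        below : (quota ⊓ Y p) * k′ ≤ x′ p * k + (k + k′)
        below = ≤-trans (*-monoˡ-≤ k′ (m⊓n≤m quota (Y p))) (≤-trans (m/n*n≤m (x′ p * k) k′) (m≤m+n _ _))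
        above : x′ p * k ≤ (quota ⊓ Y p) * k′ + (k + k′)
        above with ≤-total quota (Y p)
        ... | inj₁ quota≤Y rewrite m≤n⇒m⊓n≡m quota≤Y = begin
          x′ p * k                                   ≡⟨ m≡m%n+[m/n]*n (x′ p * k) k′ ⟩
          (x′ p * k) % k′ + quota * k′               ≡⟨ +-comm _ (quota * k′) ⟩
          quota * k′ + (x′ p * k) % k′               ≤⟨ +-monoʳ-≤ (quota * k′) (≤-trans (<⇒≤ (m%n<n (x′ p * k) k′)) (m≤n+m k′ k)) ⟩
          quota * k′ + (k + k′)                      ∎
          where open ≤-Reasoning
        ... | inj₂ Y≤quota rewrite m≥n⇒m⊓n≡n Y≤quota = begin
          x′ p * k                 ≤⟨ *-monoˡ-≤ k (countOf-𝟙≤count c′ X p) ⟩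
          Y′ p * k                 ≤⟨ upper (rescaled p) ⟩
          Y p * k′ + k             ≤⟨ +-monoʳ-≤ (Y p * k′) (m≤m+n k k′) ⟩
          Y p * k′ + (k + k′)      ∎
          where open ≤-Reasoning

    private
      Σ𝟙≤ : ∀ {N} (X : Fin N → Bool) → sum (𝟙 ∘ X) ≤ N
      Σ𝟙≤ {N} X = ≤-trans (sum-≤-const 1 (𝟙≤1 ∘ X)) (≤-reflexive (*-identityʳ N))

    module _ (S′ T′ : Fin M′ → Bool) where
      private
        s′ t′ s t : Fin K → ℕ
        s′ = countOf c′ (𝟙 ∘ S′)
        t′ = countOf c′ (𝟙 ∘ T′)
        s  = countOf c (𝟙 ∘ imitate S′)
        t  = countOf c (𝟙 ∘ imitate T′)

        Σs≤kK : sum s ≤ k * K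
        Σs≤kK = ≤-trans (≤-reflexive (sum-countOf c _)) (≤-trans (Σ𝟙≤ (imitate S′)) (≤-reflexive M≡kK))

        Σt′≤k′K : sum t′ ≤ k′ * K
        Σt′≤k′K = ≤-trans (≤-reflexive (sum-countOf c′ _)) (≤-trans (Σ𝟙≤ T′) (≤-reflexive M′≡k′K))

        scaled : ∀ (a b : Fin K → ℕ) F z → bilinear a b F * (z * z) ≡ ∑[ p < K ] ∑[ q < K ] ((a p * z) * (b q * z) * F p q)
        scaled a b F z = trans (sym (sum₂-*ʳ (z * z) (λ p q → a p * b q * F p q)))
          (sum-cong-≗ (λ p → sum-cong-≗ (λ q → solve 4 (λ a b f z → a :* b :* f :* (z :* z) := (a :* z) :* (b :* z) :* f) refl (a p) (b q) (F p q) z)))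

      bilinear-close : ∀ F → (∀ p q → F p q ≤ 1) →
        ∣ bilinear s′ t′ F * (k * k) - bilinear s t F * (k′ * k′) ∣ ≤ 2 * (k + k′) * (k * k′) * (K * K)
      bilinear-close F F≤1 = begin
        ∣ bilinear s′ t′ F * (k * k) - bilinear s t F * (k′ * k′) ∣
          ≡⟨ cong₂ ∣_-_∣ (scaled s′ t′ F k) (scaled s t F k′) ⟩
        ∣ ∑[ p < K ] ∑[ q < K ] (s′k p * t′k q * F p q) - ∑[ p < K ] ∑[ q < K ] (sk′ p * tk′ q * F p q) ∣
          ≤⟨ ≤-trans (∣sum-sum∣≤sum∣-∣ (λ p → ∑[ q < K ] (s′k p * t′k q * F p q)) (λ p → ∑[ q < K ] (sk′ p * tk′ q * F p q)))
                     (sum-mono-≤ (λ p → ∣sum-sum∣≤sum∣-∣ (λ q → s′k p * t′k q * F p q) (λ q → sk′ p * tk′ q * F p q))) ⟩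
        ∑[ p < K ] ∑[ q < K ] ∣ s′k p * t′k q * F p q - sk′ p * tk′ q * F p q ∣
          ≤⟨ sum-mono-≤ (λ p → sum-mono-≤ (λ q → ≤-trans (∣ag-bg∣≤∣a-b∣ (s′k p * t′k q) (sk′ p * tk′ q) (F p q) (F≤1 p q))
                                                        (∣xy-uv∣≤ (s′k p) (t′k q) (sk′ p) (tk′ q)))) ⟩
        ∑[ p < K ] ∑[ q < K ] (∣ s′k p - sk′ p ∣ * t′k q + sk′ p * ∣ t′k q - tk′ q ∣)
          ≤⟨ sum-mono-≤ (λ p → sum-mono-≤ (λ q → +-mono-≤ (*-monoˡ-≤ (t′k q) (imitate-close S′ p)) (*-monoʳ-≤ (sk′ p) (imitate-close T′ q)))) ⟩
        ∑[ p < K ] ∑[ q < K ] ((k + k′) * t′k q + sk′ p * (k + k′))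
          ≡⟨ sum₂-distrib-+ (λ p q → (k + k′) * t′k q) (λ p q → sk′ p * (k + k′)) ⟩
        ∑[ p < K ] ∑[ q < K ] ((k + k′) * t′k q) + ∑[ p < K ] ∑[ q < K ] (sk′ p * (k + k′))
          ≡⟨ cong₂ _+_ (trans (sum-const K (∑[ q < K ] ((k + k′) * t′k q)))
                              (cong (K *_) (trans (sum-*ˡ (k + k′) t′k) (cong ((k + k′) *_) (sum-*ʳ k t′)))))
                       (trans (sum-cong-≗ (λ p → sum-const K (sk′ p * (k + k′))))
                              (trans (sum-*ˡ K (λ p → sk′ p * (k + k′)))
                                     (cong (K *_) (trans (sum-*ʳ (k + k′) sk′) (cong (_* (k + k′)) (sum-*ʳ k′ s)))))) ⟩
        K * ((k + k′) * (sum t′ * k)) + K * (sum s * k′ * (k + k′))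
          ≤⟨ +-mono-≤ (*-monoʳ-≤ K (*-monoʳ-≤ (k + k′) (*-monoˡ-≤ k Σt′≤k′K))) (*-monoʳ-≤ K (*-monoˡ-≤ (k + k′) (*-monoˡ-≤ k′ Σs≤kK))) ⟩
        K * ((k + k′) * (k′ * K * k)) + K * (k * K * k′ * (k + k′))
          ≡⟨ solve 4 (λ K k k′ x → K :* (x :* (k′ :* K :* k)) :+ K :* (k :* K :* k′ :* x) := con 2 :* x :* (k :* k′) :* (K :* K)) refl K k k′ (k + k′) ⟩
        2 * (k + k′) * (k * k′) * (K * K) ∎
        where
        open ≤-Reasoning
        s′k t′k sk′ tk′ : Fin K → ℕ
        s′k p = s′ p * k
        t′k q = t′ q * k
        sk′ p = s p * k′
        tk′ q = t q * k′

      cut-bound : ∀ G H → (∀ p q → G p q ≤ 1) → (∀ p q → H p q ≤ 1) →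
        ∣ bilinear s′ t′ G - bilinear s′ t′ H ∣ * (k * k) ≤ ∣ bilinear s t G - bilinear s t H ∣ * (k′ * k′) + 4 * (k + k′) * (k * k′) * (K * K)
      cut-bound G H G≤1 H≤1 = begin
        ∣ bilinear s′ t′ G - bilinear s′ t′ H ∣ * (k * k)   ≡⟨ *-distribʳ-∣-∣ (k * k) (bilinear s′ t′ G) (bilinear s′ t′ H) ⟩
        ∣ g′ - h′ ∣                                        ≤⟨ ∣-∣-triangle g′ g h′ ⟩
        ∣ g′ - g ∣ + ∣ g - h′ ∣                             ≤⟨ +-monoʳ-≤ ∣ g′ - g ∣ (∣-∣-triangle g h h′) ⟩
        ∣ g′ - g ∣ + (∣ g - h ∣ + ∣ h - h′ ∣)                ≤⟨ +-mono-≤ (bilinear-close G G≤1) (+-monoʳ-≤ ∣ g - h ∣ (subst (_≤ E) (∣-∣-comm h′ h) (bilinear-close H H≤1))) ⟩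
        E + (∣ g - h ∣ + E)                                ≡⟨ cong (λ z → E + (z + E)) (sym (*-distribʳ-∣-∣ (k′ * k′) (bilinear s t G) (bilinear s t H))) ⟩
        E + (∣ bilinear s t G - bilinear s t H ∣ * (k′ * k′) + E)
          ≡⟨ solve 2 (λ e x → e :+ (x :+ e) := x :+ e :+ e) refl E (∣ bilinear s t G - bilinear s t H ∣ * (k′ * k′)) ⟩
        ∣ bilinear s t G - bilinear s t H ∣ * (k′ * k′) + E + E
          ≡⟨ trans (+-assoc _ E E) (cong (∣ bilinear s t G - bilinear s t H ∣ * (k′ * k′) +_)
               (solve 3 (λ x y z → con 2 :* x :* y :* z :+ con 2 :* x :* y :* z := con 4 :* x :* y :* z) refl (k + k′) (k * k′) (K * K))) ⟩
        ∣ bilinear s t G - bilinear s t H ∣ * (k′ * k′) + 4 * (k + k′) * (k * k′) * (K * K) ∎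
        where
        open ≤-Reasoning
        g′ h′ g h E : ℕ
        g′ = bilinear s′ t′ G * (k * k)
        h′ = bilinear s′ t′ H * (k * k)
        g  = bilinear s t G * (k′ * k′)
        h  = bilinear s t H * (k′ * k′)
        E  = 2 * (k + k′) * (k * k′) * (K * K)


module Blowups where

  open import Data.Nat as ℕ using (ℕ; suc; z≤n)
  import Data.Nat.Properties as ℕ
  open import Data.Fin using (Fin; remQuot)
  open import Data.Fin.Properties using (remQuot-combine; combine-remQuot)
  open import Data.Bool using (Bool; true; false; if_then_else_; _∧_)
  open import Data.Product using (Σ-syntax; ∃-syntax; _×_; _,_; proj₁; proj₂)
  open import Function using (_∘_)
  open import Function.Bundles using (_↔_; Inverse)
  open import Function.Construct.Identity using (↔-id)
  open import Relation.Binary.PropositionalEquality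
  open import Data.Rational
  open import Data.Rational.Properties
  open import Data.Nat.Solver using (module +-*-Solver)
  open +-*-Solver using (solve; _:*_; _:+_; _:=_; con)
  open import Defs hiding (sym)
  open FinSum using (𝟙; 𝟙≤1; δ; δ-refl; f≤sum; sum-syntax)
  open Rational
  open Norms
  open Types
  open TypeMatrices
  open Coupling
  open Rounding using (Rescaled; rescale)
  open Estimates using (quadratic; linear; module Comparison)

  quadratic-rate : ∀ X X′ k k′ K .{{_ : ℕ.NonZero k}} .{{_ : ℕ.NonZero k′}} .{{_ : ℕ.NonZero K}} →
    X′ ℕ.* (k ℕ.* k) ℕ.≤ X ℕ.* (k′ ℕ.* k′) ℕ.+ 4 ℕ.* (k ℕ.+ k′) ℕ.* (k ℕ.* k′) ℕ.* (K ℕ.* K) →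
    frac X′ ((k′ ℕ.* K) ℕ.* (k′ ℕ.* K)) ≤ frac X ((k ℕ.* K) ℕ.* (k ℕ.* K)) + (frac 4 k + frac 4 k′)
  quadratic-rate X X′ k@(suc _) k′@(suc _) K@(suc _) bound =
    subst (frac X′ ((k′ ℕ.* K) ℕ.* (k′ ℕ.* K)) ≤_) (cong (frac X ((k ℕ.* K) ℕ.* (k ℕ.* K)) +_) (sym (frac-+ 4 k 4 k′)))
      (frac≤frac+frac X ((k ℕ.* K) ℕ.* (k ℕ.* K)) X′ ((k′ ℕ.* K) ℕ.* (k′ ℕ.* K)) (4 ℕ.* k′ ℕ.+ 4 ℕ.* k) (k ℕ.* k′) (begin
        X′ ℕ.* ((k ℕ.* K) ℕ.* (k ℕ.* K)) ℕ.* (k ℕ.* k′)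
          ≡⟨ solve 4 (λ X′ k k′ K → X′ :* ((k :* K) :* (k :* K)) :* (k :* k′) := X′ :* (k :* k) :* (K :* K :* k :* k′)) refl X′ k k′ K ⟩
        X′ ℕ.* (k ℕ.* k) ℕ.* (K ℕ.* K ℕ.* k ℕ.* k′)
          ≤⟨ ℕ.*-monoˡ-≤ (K ℕ.* K ℕ.* k ℕ.* k′) bound ⟩
        (X ℕ.* (k′ ℕ.* k′) ℕ.+ 4 ℕ.* (k ℕ.+ k′) ℕ.* (k ℕ.* k′) ℕ.* (K ℕ.* K)) ℕ.* (K ℕ.* K ℕ.* k ℕ.* k′)
          ≡⟨ solve 4 (λ X k k′ K → (X :* (k′ :* k′) :+ con 4 :* (k :+ k′) :* (k :* k′) :* (K :* K)) :* (K :* K :* k :* k′)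
                       := X :* ((k′ :* K) :* (k′ :* K)) :* (k :* k′) :+ (con 4 :* k′ :+ con 4 :* k) :* ((k :* K) :* (k :* K)) :* ((k′ :* K) :* (k′ :* K)))
                     refl X k k′ K ⟩
        X ℕ.* ((k′ ℕ.* K) ℕ.* (k′ ℕ.* K)) ℕ.* (k ℕ.* k′) ℕ.+ (4 ℕ.* k′ ℕ.+ 4 ℕ.* k) ℕ.* ((k ℕ.* K) ℕ.* (k ℕ.* K)) ℕ.* ((k′ ℕ.* K) ℕ.* (k′ ℕ.* K)) ∎))
    where open ℕ.≤-Reasoning

  linear-rate : ∀ d d′ k k′ K .{{_ : ℕ.NonZero k}} .{{_ : ℕ.NonZero k′}} .{{_ : ℕ.NonZero K}} →
    d′ ℕ.* k ℕ.≤ d ℕ.* k′ ℕ.+ k ℕ.* K → frac d′ (k′ ℕ.* K) ≤ frac d (k ℕ.* K) + (frac 4 k + frac 4 k′)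
  linear-rate d d′ k@(suc _) k′@(suc _) K@(suc _) bound =
    subst (frac d′ (k′ ℕ.* K) ≤_) (cong (frac d (k ℕ.* K) +_) (sym (frac-+ 4 k 4 k′)))
      (frac≤frac+frac d (k ℕ.* K) d′ (k′ ℕ.* K) (4 ℕ.* k′ ℕ.+ 4 ℕ.* k) (k ℕ.* k′) (begin
        d′ ℕ.* (k ℕ.* K) ℕ.* (k ℕ.* k′)
          ≡⟨ solve 4 (λ d′ k k′ K → d′ :* (k :* K) :* (k :* k′) := d′ :* k :* (K :* k :* k′)) refl d′ k k′ K ⟩
        d′ ℕ.* k ℕ.* (K ℕ.* k ℕ.* k′)
          ≤⟨ ℕ.*-monoˡ-≤ (K ℕ.* k ℕ.* k′) bound ⟩
        (d ℕ.* k′ ℕ.+ k ℕ.* K) ℕ.* (K ℕ.* k ℕ.* k′)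
          ≡⟨ solve 4 (λ d k k′ K → (d :* k′ :+ k :* K) :* (K :* k :* k′) := d :* (k′ :* K) :* (k :* k′) :+ k :* (k :* K) :* (k′ :* K)) refl d k k′ K ⟩
        d ℕ.* (k′ ℕ.* K) ℕ.* (k ℕ.* k′) ℕ.+ k ℕ.* (k ℕ.* K) ℕ.* (k′ ℕ.* K)
          ≤⟨ ℕ.+-monoʳ-≤ (d ℕ.* (k′ ℕ.* K) ℕ.* (k ℕ.* k′)) (ℕ.*-monoˡ-≤ (k′ ℕ.* K) (ℕ.*-monoˡ-≤ (k ℕ.* K) k≤4k′+4k)) ⟩
        d ℕ.* (k′ ℕ.* K) ℕ.* (k ℕ.* k′) ℕ.+ (4 ℕ.* k′ ℕ.+ 4 ℕ.* k) ℕ.* (k ℕ.* K) ℕ.* (k′ ℕ.* K) ∎))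
    where
    open ℕ.≤-Reasoning
    k≤4k′+4k : k ℕ.≤ 4 ℕ.* k′ ℕ.+ 4 ℕ.* k
    k≤4k′+4k = ℕ.≤-trans (ℕ.m≤n*m k 4) (ℕ.m≤n+m (4 ℕ.* k) (4 ℕ.* k′))

  error : ℕ → ℕ → ℚ
  error k k′ = frac 4 k + frac 4 k′

  module Levels {m n : ℕ} .{{_ : ℕ.NonZero m}} .{{_ : ℕ.NonZero n}} (G : SimpleGraph m) (H : SimpleGraph n) where

    K : ℕ
    K = m ℕ.* n

    -- the orders of G^{⊙ℓn} and H^{⊙ℓm}, equal but not definitionally
    V Vᴴ : ℕ → ℕ
    V  ℓ = m ℕ.* (ℓ ℕ.* n)
    Vᴴ ℓ = n ℕ.* (ℓ ℕ.* m)

    V≡ℓK : ∀ ℓ → V ℓ ≡ ℓ ℕ.* K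
    V≡ℓK ℓ = solve 3 (λ m ℓ n → m :* (ℓ :* n) := ℓ :* (m :* n)) refl m ℓ n

    Vᴴ≡ℓK : ∀ ℓ → Vᴴ ℓ ≡ ℓ ℕ.* K
    Vᴴ≡ℓK ℓ = solve 3 (λ m ℓ n → n :* (ℓ :* m) := ℓ :* (m :* n)) refl m ℓ n

    Δ : ∀ ℓ → Fin (V ℓ) ↔ Fin (Vᴴ ℓ) → Matrix (Vᴴ ℓ) (Vᴴ ℓ)
    Δ ℓ π = permDiff (adjMat (blowup G (ℓ ℕ.* n))) π (adjMat (blowup H (ℓ ℕ.* m)))

    edgeᴳ edgeᴴ : Fin K → Fin K → Bool
    edgeᴳ p q = adj G (proj₁ (remQuot {m} n p)) (proj₁ (remQuot {m} n q))
    edgeᴴ p q = adj H (proj₂ (remQuot {m} n p)) (proj₂ (remQuot {m} n q))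

    -- the type of w: the vertices of G and H blown up to π⁻¹ w and to w
    cell : ∀ ℓ → Fin (V ℓ) ↔ Fin (Vᴴ ℓ) → Fin (Vᴴ ℓ) → Fin K
    cell ℓ = cellOf {m} {n} {ℓ ℕ.* n} {ℓ ℕ.* m}

    couplingAt : ∀ ℓ → Fin (V ℓ) ↔ Fin (Vᴴ ℓ) → Fin m → Fin n → ℕ
    couplingAt ℓ = coupling {m} {n} {ℓ ℕ.* n} {ℓ ℕ.* m}

    private
      module Typed ℓ (π : Fin (V ℓ) ↔ Fin (Vᴴ ℓ)) = TypeMatrices.TypeMatrix (cell ℓ π) edgeᴳ edgeᴴ

      if≡fromℕ𝟙 : ∀ b → (if b then 1ℚ else 0ℚ) ≡ fromℕ (𝟙 b)
      if≡fromℕ𝟙 true  = refl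
      if≡fromℕ𝟙 false = refl

    Δ≡typeMatrix : ∀ ℓ π w w′ → Δ ℓ π w w′ ≡ Typed.matrix ℓ π w w′
    Δ≡typeMatrix ℓ π w w′ = cong₂ _-_
      (trans (if≡fromℕ𝟙 _) (cong (fromℕ ∘ 𝟙) (cong₂ (adj G) (sym (cong proj₁ types)) (sym (cong proj₁ types′)))))
      (trans (if≡fromℕ𝟙 _) (cong (fromℕ ∘ 𝟙) (cong₂ (adj H) (sym (cong proj₂ types)) (sym (cong proj₂ types′)))))
      where
      types  = remQuot-combine {k = n} (block {m} (ℓ ℕ.* n) (Inverse.from π w))  (block {n} (ℓ ℕ.* m) w)
      types′ = remQuot-combine {k = n} (block {m} (ℓ ℕ.* n) (Inverse.from π w′)) (block {n} (ℓ ℕ.* m) w′)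

    D : Fin K → Fin K → ℕ
    D p q = ℕ.∣ 𝟙 (edgeᴳ p q) - 𝟙 (edgeᴴ p q) ∣

    D≤1 : ∀ p q → D p q ℕ.≤ 1
    D≤1 p q with edgeᴳ p q | edgeᴴ p q
    ... | true  | true  = z≤n
    ... | true  | false = ℕ.≤-refl
    ... | false | true  = ℕ.≤-refl
    ... | false | false = z≤n

    norm₍₁₎-Δ : ∀ ℓ π → norm₍₁₎ (Δ ℓ π) ≡ fromℕ (quadratic (count (cell ℓ π)) D)
    norm₍₁₎-Δ ℓ π = trans (Σℚ-cong (λ w → Σℚ-cong (λ w′ → cong ∣_∣ (Δ≡typeMatrix ℓ π w w′)))) (Typed.norm₍₁₎-matrix ℓ π)

    colSum₁-Δ : ∀ ℓ π w′ → colSum₁ (Δ ℓ π) w′ ≡ fromℕ (∑[ p < K ] (count (cell ℓ π) p ℕ.* D p (cell ℓ π w′)))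
    colSum₁-Δ ℓ π w′ = trans (Σℚ-cong (λ w → cong ∣_∣ (Δ≡typeMatrix ℓ π w w′))) (Typed.colSum₁-matrix ℓ π w′)

    ∣blockSum-Δ∣ : ∀ ℓ π S T → ∣ blockSum (Δ ℓ π) S T ∣ ≡ fromℕ ℕ.∣ Typed.pairs ℓ π S T edgeᴳ - Typed.pairs ℓ π S T edgeᴴ ∣
    ∣blockSum-Δ∣ ℓ π S T = trans (cong ∣_∣ (Σℚ-cong (λ w → Σℚ-cong (λ w′ → cong (if S w ∧ T w′ then_else 0ℚ) (Δ≡typeMatrix ℓ π w w′)))))
                                 (Typed.∣blockSum-matrix∣ ℓ π S T)

    count-cell : ∀ ℓ (π : Fin (V ℓ) ↔ Fin (Vᴴ ℓ)) p →
      count (cell ℓ π) p ≡ couplingAt ℓ π (proj₁ (remQuot {m} n p)) (proj₂ (remQuot {m} n p))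
    count-cell ℓ π p = cong (count (cell ℓ π)) (sym (combine-remQuot {m} n p))

    private
      instance
        K≢0 : ℕ.NonZero K
        K≢0 = ℕ.m*n≢0 m n

    some-vertex : ∀ ℓ .{{_ : ℕ.NonZero ℓ}} → Fin (Vᴴ ℓ)
    some-vertex ℓ = Data.Fin.fromℕ< (subst (0 ℕ.<_) (sym (Vᴴ≡ℓK ℓ)) (ℕ.>-nonZero⁻¹ (ℓ ℕ.* K) {{ℕ.m*n≢0 ℓ K}}))
      where import Data.Fin

    private
      *recip-mono : ∀ {x y} N → x ≤ y → x * recipℕ N ≤ y * recipℕ N
      *recip-mono N x≤y = *-monoʳ-≤-nonNeg (recipℕ N) {{nonNegative (0≤recipℕ N)}} x≤y

    -- From a bijection π at level k, a bijection π′ at level k′ whose coupling is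
    -- the coupling of π rescaled by k′/k.
    module Step (k k′ : ℕ) .{{_ : ℕ.NonZero k}} .{{_ : ℕ.NonZero k′}} (π : Fin (V k) ↔ Fin (Vᴴ k)) where

      private
        rescaled-coupling : Σ[ Y′ ∈ (Fin m → Fin n → ℕ) ] (∀ i → ∑[ j < n ] Y′ i j ≡ k′ ℕ.* n) × (∀ j → ∑[ i < m ] Y′ i j ≡ k′ ℕ.* m) ×
                                                          (∀ i j → Rescaled k k′ (couplingAt k π i j) (Y′ i j))
        rescaled-coupling = rescale k k′ (couplingAt k π) (λ _ → n) (λ _ → m)
                                    (coupling-rows {m} {n} {k ℕ.* n} {k ℕ.* m} π) (coupling-cols {m} {n} {k ℕ.* n} {k ℕ.* m} π)

        realised : Σ[ π′ ∈ Fin (V k′) ↔ Fin (Vᴴ k′) ] (∀ i j → couplingAt k′ π′ i j ≡ proj₁ rescaled-coupling i j)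
        realised = realise {m} {n} {k′ ℕ.* n} {k′ ℕ.* m} (proj₁ rescaled-coupling)
                           (proj₁ (proj₂ rescaled-coupling)) (proj₁ (proj₂ (proj₂ rescaled-coupling)))

      π′ : Fin (V k′) ↔ Fin (Vᴴ k′)
      π′ = proj₁ realised

      rescaled : ∀ p → Rescaled k k′ (count (cell k π) p) (count (cell k′ π′) p)
      rescaled p = subst₂ (Rescaled k k′) (sym (count-cell k π p)) (sym (trans (count-cell k′ π′ p) (proj₂ realised _ _)))
                          (proj₂ (proj₂ (proj₂ rescaled-coupling)) _ _)

      open Estimates.Comparison k k′ (cell k π) (cell k′ π′) rescaled (Vᴴ≡ℓK k) (Vᴴ≡ℓK k′)
      open Rescaled

      entrywise-step : ∀ d → IsNorm entrywise (Δ k π) d →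
        ∃[ e′ ] IsNorm entrywise (Δ k′ π′) e′ × e′ * scale entrywise (V k′) ≤ d * scale entrywise (V k) + error k k′
      entrywise-step d ∥Δ∥≡d = _ , norm₍₁₎-Δ k′ π′ ,
        subst₂ (λ a b → frac X′ (a ℕ.* a) ≤ b * recipℕ (V k ℕ.* V k) + error k k′) (sym (V≡ℓK k′)) (trans (sym (norm₍₁₎-Δ k π)) ∥Δ∥≡d)
          (subst (λ a → frac X′ ((k′ ℕ.* K) ℕ.* (k′ ℕ.* K)) ≤ frac X (a ℕ.* a) + error k k′) (sym (V≡ℓK k))
            (quadratic-rate X X′ k k′ K (quadratic-bound D D≤1)))
        where
        X X′ : ℕ
        X  = quadratic (count (cell k π)) D
        X′ = quadratic (count (cell k′ π′)) D

      -- The heaviest column of Δ k′ π′ has a type that also occurs at level k,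
      -- since rescaling never creates a type from nothing.
      operator-step : ∀ d → IsNorm operator (Δ k π) d →
        ∃[ e′ ] IsNorm operator (Δ k′ π′) e′ × e′ * scale operator (V k′) ≤ d * scale operator (V k) + error k k′
      operator-step d isOp = colSum₁ (Δ k′ π′) j* , isOp′ ,
        subst₂ (λ a b → a * recipℕ b ≤ d * recipℕ (V k) + error k k′) (sym (colSum₁-Δ k′ π′ j*)) (sym (V≡ℓK k′))
          (≤-trans (linear-rate (linear Y D q) (linear Y′ D q) k k′ K (linear-bound D D≤1 q))
            (+-monoˡ-≤ (error k k′) (subst (λ a → frac (linear Y D q) a ≤ d * recipℕ (V k)) (V≡ℓK k)
              (*recip-mono (V k) column-q≤d))))
        where
        j* : Fin (Vᴴ k′)
        j* = proj₁ (opNorm-attained (Δ k′ π′) (some-vertex k′))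
        isOp′ : IsOpNorm₁ (Δ k′ π′) (colSum₁ (Δ k′ π′) j*)
        isOp′ = proj₂ (opNorm-attained (Δ k′ π′) (some-vertex k′))
        q : Fin K
        q = cell k′ π′ j*
        Y′q>0 : 0 ℕ.< Y′ q
        Y′q>0 = subst (ℕ._≤ Y′ q) (δ-refl q) (f≤sum (λ w → δ (cell k′ π′ w) q) j*)
        Yq>0 : 0 ℕ.< Y q
        Yq>0 = ℕ.n≢0⇒n>0 (λ Yq≡0 → ℕ.<-irrefl (sym (zero-preserving (rescaled q) Yq≡0)) Y′q>0)
        w₀ : Fin (Vᴴ k)
        w₀ = proj₁ (count>0⇒∃ (cell k π) q Yq>0)
        column-q≤d : fromℕ (linear Y D q) ≤ d
        column-q≤d = subst (_≤ d) (trans (colSum₁-Δ k π w₀) (cong (λ x → fromℕ (linear Y D x)) (proj₂ (count>0⇒∃ (cell k π) q Yq>0))))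
                           (colSum₁≤opNorm (Δ k π) isOp w₀)

      cut-step : ∀ d → IsNorm cut (Δ k π) d →
        ∃[ e′ ] IsNorm cut (Δ k′ π′) e′ × e′ * scale cut (V k′) ≤ d * scale cut (V k) + error k k′
      cut-step d (_ , ≤d) = e′ , isCut′ ,
        subst₂ (λ a b → a * recipℕ (b ℕ.* b) ≤ d * recipℕ (V k ℕ.* V k) + error k k′)
               (trans (sym (∣blockSum-Δ∣ k′ π′ S′ T′)) e′-attained) (sym (V≡ℓK k′))
          (≤-trans (quadratic-rate X X′ k k′ K (cut-bound S′ T′ (λ p q → 𝟙 (edgeᴳ p q)) (λ p q → 𝟙 (edgeᴴ p q))
                                                         (λ p q → 𝟙≤1 (edgeᴳ p q)) (λ p q → 𝟙≤1 (edgeᴴ p q))))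
            (+-monoˡ-≤ (error k k′) (subst (λ a → frac X (a ℕ.* a) ≤ d * recipℕ (V k ℕ.* V k)) (V≡ℓK k)
              (*recip-mono (V k ℕ.* V k) (subst (_≤ d) (∣blockSum-Δ∣ k π S T) (≤d S T))))))
        where
        e′ : ℚ
        e′ = proj₁ (cutNorm-exists (Δ k′ π′))
        isCut′ : IsCutNorm (Δ k′ π′) e′
        isCut′ = proj₂ (cutNorm-exists (Δ k′ π′))
        S′ T′ : Fin (Vᴴ k′) → Bool
        S′ = proj₁ (proj₁ isCut′)
        T′ = proj₁ (proj₂ (proj₁ isCut′))
        e′-attained : ∣ blockSum (Δ k′ π′) S′ T′ ∣ ≡ e′
        e′-attained = proj₂ (proj₂ (proj₁ isCut′))
        S T : Fin (Vᴴ k) → Bool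
        S = imitate S′
        T = imitate T′
        X X′ : ℕ
        X  = ℕ.∣ Typed.pairs k π S T edgeᴳ - Typed.pairs k π S T edgeᴴ ∣
        X′ = ℕ.∣ Typed.pairs k′ π′ S′ T′ edgeᴳ - Typed.pairs k′ π′ S′ T′ edgeᴴ ∣

      step : ∀ κ d → IsNorm κ (Δ k π) d → ∃[ e′ ] IsNorm κ (Δ k′ π′) e′ × e′ * scale κ (V k′) ≤ d * scale κ (V k) + error k k′
      step entrywise = entrywise-step
      step operator  = operator-step
      step cut       = cut-step

    δ̂-step : ∀ κ k k′ .{{_ : ℕ.NonZero k}} .{{_ : ℕ.NonZero k′}} {d d′} →
      IsDist κ (blowup G (k ℕ.* n)) (blowup H (k ℕ.* m)) d → IsDist κ (blowup G (k′ ℕ.* n)) (blowup H (k′ ℕ.* m)) d′ →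
      d′ * scale κ (V k′) ≤ d * scale κ (V k) + error k k′
    δ̂-step κ k k′ ((π , isNorm) , _) (_ , minimal) =
      let e′ , isNorm′ , bound = Step.step k k′ π κ _ isNorm
      in ≤-trans (*-monoʳ-≤-nonNeg (scale κ (V k′)) {{nonNegative (0≤scale κ (V k′))}} (minimal (Step.π′ k k′ π) e′ isNorm′)) bound
      where
      0≤scale : ∀ κ N → 0ℚ ≤ scale κ N
      0≤scale entrywise N = 0≤recipℕ (N ℕ.* N)
      0≤scale operator  N = 0≤recipℕ N
      0≤scale cut       N = 0≤recipℕ (N ℕ.* N)

    δ̂-exists : ∀ κ ℓ .{{_ : ℕ.NonZero ℓ}} → ∃[ a ] IsNormDist κ (blowup G (ℓ ℕ.* n)) (blowup H (ℓ ℕ.* m)) a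
    δ̂-exists κ ℓ =
      let d , isDist = dist-exists κ (adjMat (blowup G (ℓ ℕ.* n))) (adjMat (blowup H (ℓ ℕ.* m)))
                                   (λ X → norm-exists κ X (some-vertex ℓ))
                                   (subst (λ N → Fin (V ℓ) ↔ Fin N) (trans (V≡ℓK ℓ) (sym (Vᴴ≡ℓK ℓ))) (↔-id _))
      in d * scale κ (V ℓ) , d , isDist , refl

    δ̂-close : ∀ κ ℓ ℓ′ .{{_ : ℕ.NonZero ℓ}} .{{_ : ℕ.NonZero ℓ′}} {a a′} →
      IsNormDist κ (blowup G (ℓ ℕ.* n)) (blowup H (ℓ ℕ.* m)) a → IsNormDist κ (blowup G (ℓ′ ℕ.* n)) (blowup H (ℓ′ ℕ.* m)) a′ →
      ∣ a - a′ ∣ ≤ error ℓ ℓ′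
    δ̂-close κ ℓ ℓ′ (d , isDist , refl) (d′ , isDist′ , refl) =
      ∣-∣≤-both (subst (λ e → d * scale κ (V ℓ) ≤ d′ * scale κ (V ℓ′) + e) (+-comm (frac 4 ℓ′) (frac 4 ℓ)) (δ̂-step κ ℓ′ ℓ isDist′ isDist))
                (δ̂-step κ ℓ ℓ′ isDist isDist′)


open import Defs
open import Data.Nat using (ℕ; _≤_; _*_)
open import Data.Nat using (suc)
open import Data.Product using (_,_)
open import Data.Rational.Properties using (≤-<-trans)
open Rational using (frac+frac→0)
open Blowups using (module Levels)

theorem3p4 : (m n : ℕ) → 1 ≤ m → 1 ≤ n → (G : SimpleGraph m) → (H : SimpleGraph n) →
    (κ : NormKind) →
    ConvergentRel (λ ℓ a → IsNormDist κ (blowup G (ℓ * n)) (blowup H (ℓ * m)) a)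
theorem3p4 (suc _) (suc _) _ _ G H κ =
  (λ { ℓ@(suc _) _ → δ̂-exists κ ℓ }) ,
  λ ε 0<ε → let L , small = frac+frac→0 4 ε 0<ε in
    L , λ { ℓ@(suc _) ℓ′@(suc _) _ _ L≤ℓ L≤ℓ′ _ _ δ̂ δ̂′ → ≤-<-trans (δ̂-close κ ℓ ℓ′ δ̂ δ̂′) (small ℓ ℓ′ L≤ℓ L≤ℓ′) }
  where
  open Levels G H
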